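{- Let $t\to_{\mathsf G}^{*} s$ and let $v$ be a bad value of $s$, i.e. $s=C\langle v\rangle$ with $v$ a value occurring as a subterm at that position and $C$ a bad context. Then $|v|\le|t|$.
   Context: Exponential substitution calculus. Variables: multiplicative $m,n,o,\ldots$ and exponential $e,f,g,\ldots$ (disjoint kinds); $x,y,z$ range over both. Multiplicative values $v_{\mathsf m} ::= m \mid (t,s) \mid \lambda x.t$; exponential values $v_{\mathsf e} ::= e \mid\ !t$; values $v ::= v_{\mathsf m}\mid v_{\mathsf e}$. Terms: $t,s,u ::= v \mid \mathsf{cut}(v,x.t) \mid \mathsf{par}(m,x.y.t) \mid \mathsf{sub}(m,v,x.t) \mid \mathsf{der}(e,x.t)$; in $\lambda x.t$, cut, sub, der $x$ is bound in $t$, in par $x,y$ are bound; terms up to $\alpha$; $\mathrm{fv}$ = free variables; $|t|$ = size of $t$ (number of constructor occurrences). Left contexts $L ::= \langle\cdot\rangle \mid \mathsf{cut}(v,x.L)\mid\mathsf{par}(m,x.y.L)\mid\mathsf{sub}(m,v,x.L)\mid\mathsf{der}(e,x.L)$; every term is uniquely $L\langle v\rangle$. Value contexts $V ::= \langle\cdot\rangle \mid (C,s)\mid (t,C)\mid\lambda x.C\mid\ !C$; general contexts $C ::= V \mid \mathsf{cut}(V,x.t)\mid\mathsf{sub}(m,V,x.t)\mid L\langle C\rangle$; multiplicative value contexts $V_{\mathsf m} ::= \langle\cdot\rangle\mid (M,s)\mid(t,M)\mid\lambda x.M$; multiplicative contexts $M ::= V_{\mathsf m}\mid \mathsf{cut}(V_{\mathsf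 m},x.t)\mid \mathsf{sub}(m,V_{\mathsf m},x.t)\mid L\langle M\rangle$. Plugging $C\langle t\rangle$ replaces the hole (may capture), except that if $t=L\langle v\rangle$ then $\mathsf{cut}(\langle\cdot\rangle,x.s)\langle t\rangle := L\langle\mathsf{cut}(v,x.s)\rangle$ and $\mathsf{sub}(m,\langle\cdot\rangle,x.s)\langle t\rangle := L\langle\mathsf{sub}(m,v,x.s)\rangle$; $C\langle\!\langle t\rangle\!\rangle$ is capture-avoiding plugging. For multiplicative $m,n$, $\{n/m\}t$ is renaming. Micro-step root rules (context does not capture the cut variable): (ax$_{m1}$) $\mathsf{cut}(v_{\mathsf m},m.M\langle\!\langle m\rangle\!\rangle)\mapsto M\langle\!\langle v_{\mathsf m}\rangle\!\rangle$; (ax$_{m2}$) $\mathsf{cut}(n,m.t)\mapsto \{n/m\}t$; ($\otimes$) $\mathsf{cut}((s,u),m.M\langle\mathsf{par}(m,x.y.t)\rangle)\mapsto M\langle L\langle\mathsf{cut}(v,x.L'\langle\mathsf{cut}(v',y.t)\rangle)\rangle\rangle$ where $s=L\langle v\rangle$, $u=L'\langle v'\rangle$; ($\multimap$) $\mathsf{cut}(\lambda y.s,m.M\langle\mathsf{sub}(m,v,x.t)\rangle)\mapsto M\langle\mathsf{cut}(v,y.L\langle\mathsf{cut}(v',x.t)\rangle)\rangle$ where $s=L\langle v'\rangle$; (ax$_{e1}$) $\mathsf{cut}(v_{\mathsf e},e.C\langle\!\langle e\rangle\!\rangle)\mapsto\mathsf{cut}(v_{\mathsf e},e.C\langle\!\langle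 v_{\mathsf e}\rangle\!\rangle)$; (ax$_{e2}$) $\mathsf{cut}(f,e.C\langle\mathsf{der}(e,x.t)\rangle)\mapsto\mathsf{cut}(f,e.C\langle\mathsf{der}(f,x.t)\rangle)$; (!der) $\mathsf{cut}(!s,e.C\langle\mathsf{der}(e,x.t)\rangle)\mapsto\mathsf{cut}(!s,e.C\langle L\langle\mathsf{cut}(v,x.t)\rangle\rangle)$ where $s=L\langle v\rangle$; (w) $\mathsf{cut}(v_{\mathsf e},e.t)\mapsto t$ if $e\notin\mathrm{fv}(t)$. $\to_{\mathrm{ms}}$ is the union of their closures under general contexts. Positions of redexes: every non-(w) step reduces a term $t=C\langle\mathsf{cut}(v,x.D\langle t_x\rangle)\rangle$ where the fired cut is the one on $x$ and $t_x$ is the occurrence of $x$ it acts on (a subterm of form $x$, $\mathsf{par}(x,\ldots)$, $\mathsf{sub}(x,\ldots)$ or $\mathsf{der}(x,\ldots)$); its position is $C\langle\mathsf{cut}(v,x.D)\rangle$. A (w) step $C\langle t\rangle\to C\langle s\rangle$ with $t\mapsto_w s$ has position $C$. In positions, the plugged term is an actual subterm. Dominating free variables $\mathrm{dfv}(C)$: $\mathrm{dfv}(\langle\cdot\rangle)=\emptyset$; $\mathrm{dfv}((C,v))=\mathrm{dfv}((v,C))=\mathrm{dfv}(!C)=\mathrm{dfv}(C)$; $\mathrm{dfv}(\lambda x.C)=\mathrm{dfv}(C)\setminus\{x\}$; $\mathrm{dfv}(\mathsf{cut}(v,x.C))=\mathrm{dfv}(C)\setminus\{x\}$; $\mathrm{dfv}(\mathsf{cut}(V,x.t))=\mathrm{dfv}(V)$;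 $\mathrm{dfv}(\mathsf{par}(m,x.y.C))=\{m\}\cup(\mathrm{dfv}(C)\setminus\{x,y\})$ if $x\in\mathrm{dfv}(C)$ or $y\in\mathrm{dfv}(C)$, else $\mathrm{dfv}(C)$; $\mathrm{dfv}(\mathsf{sub}(m,V,x.t))=\{m\}\cup\mathrm{dfv}(V)$; $\mathrm{dfv}(\mathsf{sub}(m,v,x.C))=\{m\}\cup(\mathrm{dfv}(C)\setminus\{x\})$ if $x\in\mathrm{dfv}(C)$, else $\mathrm{dfv}(C)$; $\mathrm{dfv}(\mathsf{der}(e,x.C))=\{e\}\cup(\mathrm{dfv}(C)\setminus\{x\})$ if $x\in\mathrm{dfv}(C)$, else $\mathrm{dfv}(C)$. Good value contexts $V_G ::= \langle\cdot\rangle\mid(G,t)\mid(t,G)\mid\lambda x.G\mid\ !G$; good contexts $G ::= V_G\mid\mathsf{par}(m,x.y.G)\mid\mathsf{sub}(m,v,x.G)\mid\mathsf{sub}(m,V_G,x.t)\mid\mathsf{der}(e,x.G)\mid\mathsf{cut}(v,x.G)$ provided $x\notin\mathrm{dfv}(G)$. A bad context is a context that is not good. A $\to_{\mathrm{ms}}$ step is good, written $\to_{\mathsf G}$, if its position is a good context. -}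

module Defs where

open import Data.Nat using (ℕ; suc; _+_; _≤_)
open import Data.List using (List; []; _∷_; _++_)
open import Data.Product using (Σ; _×_; _,_)
open import Data.Sum using (_⊎_)
open import Data.Unit using (⊤)
open import Data.Empty using (⊥)
open import Relation.Nullary using (¬_)
open import Relation.Binary.PropositionalEquality using (_≡_)
open import Relation.Binary.Construct.Closure.ReflexiveTransitive using (Star)

-- Terms up to α-equivalence are represented by intrinsically scoped
-- de Bruijn terms; each binder carries the kind of the variable it binds.

data Kind : Set where
  𝕞 𝕖 : Kind      -- multiplicative / exponential

Scope : Set
Scope = List Kind

infix 4 _∋_
data _∋_ : Scope → Kind → Set where
  here  : ∀ {Γ k} → (k ∷ Γ) ∋ k
  there : ∀ {Γ k k'} → Γ ∋ k → (k' ∷ Γ) ∋ k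

-- same variable (possibly at different a-priori kinds)
SameVar : ∀ {Γ k k'} → Γ ∋ k → Γ ∋ k' → Set
SameVar here      here      = ⊤
SameVar here      (there _) = ⊥
SameVar (there _) here      = ⊥
SameVar (there x) (there y) = SameVar x y

-- Values and terms.
--   par m k₁ k₂ t  is  par(m, x.y.t)  with x : k₁ (index 1), y : k₂ (index 0)

data Val (Γ : Scope) : Set
data Tm  (Γ : Scope) : Set

data Val Γ where
  mvar : Γ ∋ 𝕞 → Val Γ
  pair : Tm Γ → Tm Γ → Val Γ
  lam  : (k : Kind) → Tm (k ∷ Γ) → Val Γ
  evar : Γ ∋ 𝕖 → Val Γ
  bang : Tm Γ → Val Γ

data Tm Γ where
  val : Val Γ → Tm Γ
  cut : (k : Kind) → Val Γ → Tm (k ∷ Γ) → Tm Γ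
  par : Γ ∋ 𝕞 → (k₁ k₂ : Kind) → Tm (k₂ ∷ k₁ ∷ Γ) → Tm Γ
  sub : Γ ∋ 𝕞 → Val Γ → (k : Kind) → Tm (k ∷ Γ) → Tm Γ
  der : Γ ∋ 𝕖 → (k : Kind) → Tm (k ∷ Γ) → Tm Γ

IsMultV : ∀ {Γ} → Val Γ → Set
IsMultV (mvar _)   = ⊤
IsMultV (pair _ _) = ⊤
IsMultV (lam _ _)  = ⊤
IsMultV (evar _)   = ⊥
IsMultV (bang _)   = ⊥

IsExpV : ∀ {Γ} → Val Γ → Set
IsExpV (mvar _)   = ⊥
IsExpV (pair _ _) = ⊥
IsExpV (lam _ _)  = ⊥
IsExpV (evar _)   = ⊤
IsExpV (bang _)   = ⊤

-- Size = number of constructor occurrences (variable names in the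
-- first slot of par/sub/der are not subterms and are not counted).

sizeV : ∀ {Γ} → Val Γ → ℕ
sizeT : ∀ {Γ} → Tm Γ → ℕ
sizeV (mvar _)   = 1
sizeV (pair t s) = suc (sizeT t + sizeT s)
sizeV (lam _ t)  = suc (sizeT t)
sizeV (evar _)   = 1
sizeV (bang t)   = suc (sizeT t)
sizeT (val v)       = sizeV v
sizeT (cut _ v t)   = suc (sizeV v + sizeT t)
sizeT (par _ _ _ t) = suc (sizeT t)
sizeT (sub _ v _ t) = suc (sizeV v + sizeT t)
sizeT (der _ _ t)   = suc (sizeT t)

Ren : Scope → Scope → Set
Ren Γ Δ = ∀ {k} → Γ ∋ k → Δ ∋ k

ext : ∀ {Γ Δ k} → Ren Γ Δ → Ren (k ∷ Γ) (k ∷ Δ)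
ext ρ here      = here
ext ρ (there x) = there (ρ x)

renV : ∀ {Γ Δ} → Ren Γ Δ → Val Γ → Val Δ
renT : ∀ {Γ Δ} → Ren Γ Δ → Tm Γ → Tm Δ
renV ρ (mvar x)   = mvar (ρ x)
renV ρ (pair t s) = pair (renT ρ t) (renT ρ s)
renV ρ (lam k t)  = lam k (renT (ext ρ) t)
renV ρ (evar x)   = evar (ρ x)
renV ρ (bang t)   = bang (renT ρ t)
renT ρ (val v)         = val (renV ρ v)
renT ρ (cut k v t)     = cut k (renV ρ v) (renT (ext ρ) t)
renT ρ (par m k₁ k₂ t) = par (ρ m) k₁ k₂ (renT (ext (ext ρ)) t)
renT ρ (sub m v k t)   = sub (ρ m) (renV ρ v) k (renT (ext ρ) t)
renT ρ (der e k t)     = der (ρ e) k (renT (ext ρ) t)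

ren1 : ∀ {Γ} → Γ ∋ 𝕞 → Ren (𝕞 ∷ Γ) Γ
ren1 n here      = n
ren1 n (there x) = x

-- Binder lists: a context binding Θ (outermost binder first) has hole
-- scope  Θ ⋈ Γ .

_⋈_ : List Kind → Scope → Scope
[]      ⋈ Γ = Γ
(k ∷ Θ) ⋈ Γ = Θ ⋈ (k ∷ Γ)

wkΘ : ∀ {Γ} (Θ : List Kind) → Ren Γ (Θ ⋈ Γ)
wkΘ []      x = x
wkΘ (k ∷ Θ) x = wkΘ Θ (there x)

liftΘ : ∀ {Γ Δ} (Θ : List Kind) → Ren Γ Δ → Ren (Θ ⋈ Γ) (Θ ⋈ Δ)
liftΘ []      ρ x = ρ x
liftΘ (k ∷ Θ) ρ x = liftΘ Θ (ext ρ) x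

-- Ctx s Γ s' Θ : outer syntactic sort s in scope Γ, hole of sort s'
-- under binders Θ (hole scope Θ ⋈ Γ).  These are exactly the general
-- contexts C of the paper (value contexts V are those with outer sort V).

data Sort : Set where
  T V : Sort

El : Sort → Scope → Set
El T Γ = Tm Γ
El V Γ = Val Γ

data Ctx : Sort → Scope → Sort → List Kind → Set where
  hole  : ∀ {s Γ} → Ctx s Γ s []
  pairL : ∀ {Γ s Θ} → Ctx T Γ s Θ → Tm Γ → Ctx V Γ s Θ
  pairR : ∀ {Γ s Θ} → Tm Γ → Ctx T Γ s Θ → Ctx V Γ s Θ
  lamC  : ∀ {Γ s Θ} (k : Kind) → Ctx T (k ∷ Γ) s Θ → Ctx V Γ s (k ∷ Θ)
  bangC : ∀ {Γ s Θ} → Ctx T Γ s Θ → Ctx V Γ s Θ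
  valC  : ∀ {Γ s Θ} → Ctx V Γ s Θ → Ctx T Γ s Θ
  cutV  : ∀ {Γ s Θ} (k : Kind) → Ctx V Γ s Θ → Tm (k ∷ Γ) → Ctx T Γ s Θ
  cutB  : ∀ {Γ s Θ} (k : Kind) → Val Γ → Ctx T (k ∷ Γ) s Θ → Ctx T Γ s (k ∷ Θ)
  parB  : ∀ {Γ s Θ} → Γ ∋ 𝕞 → (k₁ k₂ : Kind) → Ctx T (k₂ ∷ k₁ ∷ Γ) s Θ
          → Ctx T Γ s (k₁ ∷ k₂ ∷ Θ)
  subV  : ∀ {Γ s Θ} → Γ ∋ 𝕞 → Ctx V Γ s Θ → (k : Kind) → Tm (k ∷ Γ) → Ctx T Γ s Θ
  subB  : ∀ {Γ s Θ} → Γ ∋ 𝕞 → Val Γ → (k : Kind) → Ctx T (k ∷ Γ) s Θ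
          → Ctx T Γ s (k ∷ Θ)
  derB  : ∀ {Γ s Θ} → Γ ∋ 𝕖 → (k : Kind) → Ctx T (k ∷ Γ) s Θ → Ctx T Γ s (k ∷ Θ)

-- plain (capturing) plugging: the plugged term is an actual subterm
plug : ∀ {s Γ s' Θ} → Ctx s Γ s' Θ → El s' (Θ ⋈ Γ) → El s Γ
plug hole           u = u
plug (pairL C t)    u = pair (plug C u) t
plug (pairR t C)    u = pair t (plug C u)
plug (lamC k C)     u = lam k (plug C u)
plug (bangC C)      u = bang (plug C u)
plug (valC C)       u = val (plug C u)
plug (cutV k C t)   u = cut k (plug C u) t
plug (cutB k v C)   u = cut k v (plug C u)
plug (parB m k₁ k₂ C) u = par m k₁ k₂ (plug C u)
plug (subV m C k t) u = sub m (plug C u) k t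
plug (subB m v k C) u = sub m v k (plug C u)
plug (derB e k C)   u = der e k (plug C u)

compose : ∀ {s₁ Γ s₂ Θ₁ s₃ Θ₂} → Ctx s₁ Γ s₂ Θ₁ → Ctx s₂ (Θ₁ ⋈ Γ) s₃ Θ₂
          → Ctx s₁ Γ s₃ (Θ₁ ++ Θ₂)
compose hole             D = D
compose (pairL C t)      D = pairL (compose C D) t
compose (pairR t C)      D = pairR t (compose C D)
compose (lamC k C)       D = lamC k (compose C D)
compose (bangC C)        D = bangC (compose C D)
compose (valC C)         D = valC (compose C D)
compose (cutV k C t)     D = cutV k (compose C D) t
compose (cutB k v C)     D = cutB k v (compose C D)
compose (parB m k₁ k₂ C) D = parB m k₁ k₂ (compose C D)
compose (subV m C k t)   D = subV m (compose C D) k t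
compose (subB m v k C)   D = subB m v k (compose C D)
compose (derB e k C)     D = derB e k (compose C D)

renC : ∀ {s Γ Γ' s' Θ} → Ren Γ Γ' → Ctx s Γ s' Θ → Ctx s Γ' s' Θ
renC ρ hole             = hole
renC ρ (pairL C t)      = pairL (renC ρ C) (renT ρ t)
renC ρ (pairR t C)      = pairR (renT ρ t) (renC ρ C)
renC ρ (lamC k C)       = lamC k (renC (ext ρ) C)
renC ρ (bangC C)        = bangC (renC ρ C)
renC ρ (valC C)         = valC (renC ρ C)
renC ρ (cutV k C t)     = cutV k (renC ρ C) (renT (ext ρ) t)
renC ρ (cutB k v C)     = cutB k (renV ρ v) (renC (ext ρ) C)
renC ρ (parB m k₁ k₂ C) = parB (ρ m) k₁ k₂ (renC (ext (ext ρ)) C)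
renC ρ (subV m C k t)   = subV (ρ m) (renC ρ C) k (renT (ext ρ) t)
renC ρ (subB m v k C)   = subB (ρ m) (renV ρ v) k (renC (ext ρ) C)
renC ρ (derB e k C)     = derB (ρ e) k (renC (ext ρ) C)

IsL : ∀ {s Γ s' Θ} → Ctx s Γ s' Θ → Set
IsL {T} hole         = ⊤
IsL {V} hole         = ⊥
IsL (pairL C t)      = ⊥
IsL (pairR t C)      = ⊥
IsL (lamC k C)       = ⊥
IsL (bangC C)        = ⊥
IsL (valC C)         = ⊥
IsL (cutV k C t)     = ⊥
IsL (cutB k v C)     = IsL C
IsL (parB m k₁ k₂ C) = IsL C
IsL (subV m C k t)   = ⊥
IsL (subB m v k C)   = IsL C
IsL (derB e k C)     = IsL C

IsM : ∀ {s Γ s' Θ} → Ctx s Γ s' Θ → Set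
IsM hole             = ⊤
IsM (pairL C t)      = IsM C
IsM (pairR t C)      = IsM C
IsM (lamC k C)       = IsM C
IsM (bangC C)        = ⊥
IsM (valC C)         = IsM C
IsM (cutV k C t)     = IsM C
IsM (cutB k v C)     = IsM C
IsM (parB m k₁ k₂ C) = IsM C
IsM (subV m C k t)   = IsM C
IsM (subB m v k C)   = IsM C
IsM (derB e k C)     = IsM C

_∈dfv_ : ∀ {s Γ s' Θ k} → Γ ∋ k → Ctx s Γ s' Θ → Set
x ∈dfv hole             = ⊥
x ∈dfv pairL C t        = x ∈dfv C
x ∈dfv pairR t C        = x ∈dfv C
x ∈dfv lamC k C         = there x ∈dfv C
x ∈dfv bangC C          = x ∈dfv C
x ∈dfv valC C           = x ∈dfv C
x ∈dfv cutV k C t       = x ∈dfv C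
x ∈dfv cutB k v C       = there x ∈dfv C
x ∈dfv parB m k₁ k₂ C   =
  (there (there x) ∈dfv C) ⊎ (SameVar x m × ((here ∈dfv C) ⊎ (there here ∈dfv C)))
x ∈dfv subV m C k t     = SameVar x m ⊎ (x ∈dfv C)
x ∈dfv subB m v k C     = (there x ∈dfv C) ⊎ (SameVar x m × (here ∈dfv C))
x ∈dfv derB e k C       = (there x ∈dfv C) ⊎ (SameVar x e × (here ∈dfv C))

-- Good contexts G (value contexts with outer sort V that are good are
-- exactly the good value contexts V_G).

Good : ∀ {s Γ s' Θ} → Ctx s Γ s' Θ → Set
Good hole             = ⊤
Good (pairL C t)      = Good C
Good (pairR t C)      = Good C
Good (lamC k C)       = Good C
Good (bangC C)        = Good C
Good (valC C)         = Good C
Good (cutV k C t)     = ⊥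
Good (cutB k v C)     = Good C × ¬ (here ∈dfv C)
Good (parB m k₁ k₂ C) = Good C
Good (subV m C k t)   = Good C
Good (subB m v k C)   = Good C
Good (derB e k C)     = Good C

Bad : ∀ {s Γ s' Θ} → Ctx s Γ s' Θ → Set
Bad C = ¬ Good C

-- Occurrences t_x of a variable x: x itself (value sort), or
-- par(x,…), sub(x,…), der(x,…) (term sort).

data OccV {Δ} : ∀ {k} → Δ ∋ k → Val Δ → Set where
  occ-m : (x : Δ ∋ 𝕞) → OccV x (mvar x)
  occ-e : (x : Δ ∋ 𝕖) → OccV x (evar x)

data OccT {Δ} : ∀ {k} → Δ ∋ k → Tm Δ → Set where
  occ-par : (x : Δ ∋ 𝕞) (k₁ k₂ : Kind) (t : Tm (k₂ ∷ k₁ ∷ Δ)) → OccT x (par x k₁ k₂ t)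
  occ-sub : (x : Δ ∋ 𝕞) (w : Val Δ) (k : Kind) (t : Tm (k ∷ Δ)) → OccT x (sub x w k t)
  occ-der : (x : Δ ∋ 𝕖) (k : Kind) (t : Tm (k ∷ Δ)) → OccT x (der x k t)

Occ : ∀ {Δ k} (s : Sort) → Δ ∋ k → El s Δ → Set
Occ T x u = OccT x u
Occ V x u = OccV x u

-- RootStep k v body r D :  cut(v, x.body) ↦ r  (x of kind k is the
-- de Bruijn variable 'here' of body), acting on the occurrence of x at
-- the hole of D (body = D⟨t_x⟩).  Capture-avoidance ("the context does
-- not capture the cut variable", capture-avoiding plugging ⟨⟨·⟩⟩) is by
-- de Bruijn weakening.

data RootStep {Γ : Scope} : (k : Kind) → Val Γ → Tm (k ∷ Γ) → Tm Γ
                          → ∀ {s Θ} → Ctx T (k ∷ Γ) s Θ → Set where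
  -- (ax_m1) cut(v_m, m.M⟨⟨m⟩⟩) ↦ M⟨⟨v_m⟩⟩
  ax-m1 : ∀ {Θ} (v : Val Γ) (body : Tm (𝕞 ∷ Γ)) (r : Tm Γ)
          (M : Ctx T Γ V Θ) → IsMultV v → IsM M
        → body ≡ plug (renC there M) (mvar (wkΘ Θ here))
        → r ≡ plug M (renV (wkΘ Θ) v)
        → RootStep 𝕞 v body r (renC there M)
  -- (ax_m2) cut(n, m.t) ↦ {n/m}t ; D locates the occurrence of m
  ax-m2 : ∀ {s Θ} (n : Γ ∋ 𝕞) (body : Tm (𝕞 ∷ Γ)) (r : Tm Γ)
          (D : Ctx T (𝕞 ∷ Γ) s Θ) (u : El s (Θ ⋈ (𝕞 ∷ Γ)))
        → body ≡ plug D u → Occ s (wkΘ Θ here) u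
        → r ≡ renT (ren1 n) body
        → RootStep 𝕞 (mvar n) body r D
  -- (⊗) cut((s,u), m.M⟨par(m,x.y.t)⟩) ↦ M⟨L⟨cut(v,x.L'⟨cut(v',y.t)⟩)⟩⟩
  tensor : ∀ {Θ Φ Φ' k₁ k₂} (s u : Tm Γ) (body : Tm (𝕞 ∷ Γ)) (r : Tm Γ)
           (M : Ctx T Γ T Θ) → IsM M →
           (t : Tm (k₂ ∷ k₁ ∷ (Θ ⋈ Γ))) →
           (L : Ctx T Γ T Φ) → IsL L → (v₁ : Val (Φ ⋈ Γ)) → plug L (val v₁) ≡ s
         → (L' : Ctx T Γ T Φ') → IsL L' → (v₂ : Val (Φ' ⋈ Γ)) → plug L' (val v₂) ≡ u
         → body ≡ plug (renC there M)
                       (par (wkΘ Θ here) k₁ k₂ (renT (ext (ext (liftΘ Θ there))) t))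
         → r ≡ plug M
                 (plug (renC (wkΘ Θ) L)
                   (cut k₁ (renV (liftΘ Φ (wkΘ Θ)) v₁)
                     (plug (renC (λ x → there (wkΘ Φ (wkΘ Θ x))) L')
                       (cut k₂ (renV (liftΘ Φ' (λ x → there (wkΘ Φ (wkΘ Θ x)))) v₂)
                         (renT (ext (λ a → wkΘ Φ' (ext (wkΘ Φ) a))) t)))))
         → RootStep 𝕞 (pair s u) body r (renC there M)
  -- (⊸) cut(λy.s, m.M⟨sub(m,v,x.t)⟩) ↦ M⟨cut(v, y.L⟨cut(v',x.t)⟩)⟩
  lolli : ∀ {Θ Φ} (ky kx : Kind) (s : Tm (ky ∷ Γ)) (body : Tm (𝕞 ∷ Γ)) (r : Tm Γ)
          (M : Ctx T Γ T Θ) → IsM M →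
          (w : Val (Θ ⋈ Γ)) (t : Tm (kx ∷ (Θ ⋈ Γ))) →
          (L : Ctx T (ky ∷ Γ) T Φ) → IsL L → (v' : Val (Φ ⋈ (ky ∷ Γ))) → plug L (val v') ≡ s
        → body ≡ plug (renC there M)
                      (sub (wkΘ Θ here) (renV (liftΘ Θ there) w) kx
                           (renT (ext (liftΘ Θ there)) t))
        → r ≡ plug M
                (cut ky w
                  (plug (renC (ext (wkΘ Θ)) L)
                    (cut kx (renV (liftΘ Φ (ext (wkΘ Θ))) v')
                      (renT (ext (λ a → wkΘ Φ (there a))) t))))
        → RootStep 𝕞 (lam ky s) body r (renC there M)
  -- (ax_e1) cut(v_e, e.C⟨⟨e⟩⟩) ↦ cut(v_e, e.C⟨⟨v_e⟩⟩)
  ax-e1 : ∀ {Θ} (v : Val Γ) (body : Tm (𝕖 ∷ Γ)) (r : Tm Γ)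
          (C : Ctx T (𝕖 ∷ Γ) V Θ) → IsExpV v
        → body ≡ plug C (evar (wkΘ Θ here))
        → r ≡ cut 𝕖 v (plug C (renV (λ x → wkΘ Θ (there x)) v))
        → RootStep 𝕖 v body r C
  -- (ax_e2) cut(f, e.C⟨der(e,x.t)⟩) ↦ cut(f, e.C⟨der(f,x.t)⟩)
  ax-e2 : ∀ {Θ} (f : Γ ∋ 𝕖) (body : Tm (𝕖 ∷ Γ)) (r : Tm Γ)
          (C : Ctx T (𝕖 ∷ Γ) T Θ) (kx : Kind) (t : Tm (kx ∷ (Θ ⋈ (𝕖 ∷ Γ))))
        → body ≡ plug C (der (wkΘ Θ here) kx t)
        → r ≡ cut 𝕖 (evar f) (plug C (der (wkΘ Θ (there f)) kx t))
        → RootStep 𝕖 (evar f) body r C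
  -- (!der) cut(!s, e.C⟨der(e,x.t)⟩) ↦ cut(!s, e.C⟨L⟨cut(v,x.t)⟩⟩)
  bang-der : ∀ {Θ Φ} (s : Tm Γ) (body : Tm (𝕖 ∷ Γ)) (r : Tm Γ)
             (C : Ctx T (𝕖 ∷ Γ) T Θ) (kx : Kind) (t : Tm (kx ∷ (Θ ⋈ (𝕖 ∷ Γ))))
             (L : Ctx T Γ T Φ) → IsL L → (v : Val (Φ ⋈ Γ)) → plug L (val v) ≡ s
           → body ≡ plug C (der (wkΘ Θ here) kx t)
           → r ≡ cut 𝕖 (bang s)
                   (plug C
                     (plug (renC (λ x → wkΘ Θ (there x)) L)
                       (cut kx (renV (liftΘ Φ (λ x → wkΘ Θ (there x))) v)
                         (renT (ext (wkΘ Φ)) t))))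
           → RootStep 𝕖 (bang s) body r C

-- (w) cut(v_e, e.t) ↦ t  if e ∉ fv(t)
data WStep {Γ : Scope} : Tm Γ → Tm Γ → Set where
  weak : (v : Val Γ) (u r : Tm Γ) → IsExpV v → u ≡ cut 𝕖 v (renT there r) → WStep u r

record Pos (Γ : Scope) : Set where
  constructor mkPos
  field
    {hsort}   : Sort
    {binders} : List Kind
    ctx       : Ctx T Γ hsort binders

data StepAt {Γ : Scope} (t s : Tm Γ) (p : Pos Γ) : Set where
  -- non-(w) step: t = C⟨cut(v,x.D⟨t_x⟩)⟩, position C⟨cut(v,x.D)⟩
  root-step : ∀ {Θ₁ k s' Θ₂} (C : Ctx T Γ T Θ₁) (v : Val (Θ₁ ⋈ Γ))
              (body : Tm (k ∷ (Θ₁ ⋈ Γ))) (r : Tm (Θ₁ ⋈ Γ))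
              (D : Ctx T (k ∷ (Θ₁ ⋈ Γ)) s' Θ₂)
            → RootStep k v body r D
            → t ≡ plug C (cut k v body) → s ≡ plug C r
            → p ≡ mkPos (compose C (cutB k v D))
            → StepAt t s p
  -- (w) step C⟨u⟩ → C⟨r⟩, position C
  w-step : ∀ {Θ} (C : Ctx T Γ T Θ) (u r : Tm (Θ ⋈ Γ))
         → WStep u r → t ≡ plug C u → s ≡ plug C r
         → p ≡ mkPos C
         → StepAt t s p

_→ms_ : ∀ {Γ} → Tm Γ → Tm Γ → Set
_→ms_ {Γ} t s = Σ (Pos Γ) (λ p → StepAt t s p)

_→G_ : ∀ {Γ} → Tm Γ → Tm Γ → Set
_→G_ {Γ} t s = Σ (Pos Γ) (λ p → StepAt t s p × Good (Pos.ctx p))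

_→G*_ : ∀ {Γ} → Tm Γ → Tm Γ → Set
_→G*_ = Star _→G_

-- Read a good step t →G s backwards.  Every value occurrence w of the reduct s is
--   (i)   the descendant of an occurrence w' of t with |w| ≤ |w'| whose context is good
--         only if the context of w is good,
--   (ii)  created inside the position of the step, hence in a good context, or
--   (iii) no larger than the value v of the fired cut, and v itself sits in t in the
--         context cut(⟨·⟩, x.u), which is bad.
-- So every bad value of s is bounded by a bad value of t, and by induction on the
-- reduction by |t|.  Goodness of a context depends on its dominating free variables,
-- so for (i) the tracing also relates every dominating variable of the new context to
-- one of the old context, through a relation between the two scopes.
module Submission where

open import Defs
open import Data.Nat using (ℕ; suc; _+_; _≤_)
open import Data.Nat.Properties
  using (≤-refl; ≤-trans; ≤-reflexive; <⇒≤; n≤1+n; m≤n⇒m≤1+n; m≤n⇒m≤n+o; m≤n⇒m≤o+n; m+n≤o⇒m≤o; m+n≤o⇒n≤o)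
open import Data.List using (List; []; _∷_)
open import Data.Product using (Σ; _×_; _,_; proj₁; proj₂)
open import Data.Sum using (_⊎_; inj₁; inj₂)
open import Data.Unit using (⊤; tt)
open import Data.Empty using (⊥; ⊥-elim)
open import Function using (id; _∘_)
open import Relation.Nullary using (¬_)
open import Relation.Binary.PropositionalEquality using (_≡_; refl; sym; trans; cong; cong₂; subst)
open import Relation.Binary.Construct.Closure.ReflexiveTransitive using (ε; _◅_)

data Plugged : ∀ {s Γ s' Θ} → Ctx s Γ s' Θ → El s' (Θ ⋈ Γ) → El s Γ → Set where
  p-hole  : ∀ {s Γ} {u : El s Γ} → Plugged {s} {Γ} {s} {[]} hole u u
  p-pairL : ∀ {Γ s Θ} {C : Ctx T Γ s Θ} {u a t} → Plugged C u a → Plugged (pairL C t) u (pair a t)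
  p-pairR : ∀ {Γ s Θ} {C : Ctx T Γ s Θ} {u a t} → Plugged C u a → Plugged (pairR t C) u (pair t a)
  p-lamC  : ∀ {Γ s Θ k} {C : Ctx T (k ∷ Γ) s Θ} {u a} → Plugged C u a → Plugged (lamC k C) u (lam k a)
  p-bangC : ∀ {Γ s Θ} {C : Ctx T Γ s Θ} {u a} → Plugged C u a → Plugged (bangC C) u (bang a)
  p-valC  : ∀ {Γ s Θ} {C : Ctx V Γ s Θ} {u a} → Plugged C u a → Plugged (valC C) u (val a)
  p-cutV  : ∀ {Γ s Θ k} {C : Ctx V Γ s Θ} {u a t} → Plugged C u a → Plugged (cutV k C t) u (cut k a t)
  p-cutB  : ∀ {Γ s Θ k v} {C : Ctx T (k ∷ Γ) s Θ} {u a} → Plugged C u a → Plugged (cutB k v C) u (cut k v a)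
  p-parB  : ∀ {Γ s Θ m k₁ k₂} {C : Ctx T (k₂ ∷ k₁ ∷ Γ) s Θ} {u a} → Plugged C u a → Plugged (parB m k₁ k₂ C) u (par m k₁ k₂ a)
  p-subV  : ∀ {Γ s Θ m k t} {C : Ctx V Γ s Θ} {u a} → Plugged C u a → Plugged (subV m C k t) u (sub m a k t)
  p-subB  : ∀ {Γ s Θ m v k} {C : Ctx T (k ∷ Γ) s Θ} {u a} → Plugged C u a → Plugged (subB m v k C) u (sub m v k a)
  p-derB  : ∀ {Γ s Θ e k} {C : Ctx T (k ∷ Γ) s Θ} {u a} → Plugged C u a → Plugged (derB e k C) u (der e k a)

plugged-plug : ∀ {s Γ s' Θ} (C : Ctx s Γ s' Θ) (u : El s' (Θ ⋈ Γ)) → Plugged C u (plug C u)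
plugged-plug hole u = p-hole
plugged-plug (pairL C t) u = p-pairL (plugged-plug C u)
plugged-plug (pairR t C) u = p-pairR (plugged-plug C u)
plugged-plug (lamC k C) u = p-lamC (plugged-plug C u)
plugged-plug (bangC C) u = p-bangC (plugged-plug C u)
plugged-plug (valC C) u = p-valC (plugged-plug C u)
plugged-plug (cutV k C t) u = p-cutV (plugged-plug C u)
plugged-plug (cutB k v C) u = p-cutB (plugged-plug C u)
plugged-plug (parB m k₁ k₂ C) u = p-parB (plugged-plug C u)
plugged-plug (subV m C k t) u = p-subV (plugged-plug C u)
plugged-plug (subB m v k C) u = p-subB (plugged-plug C u)
plugged-plug (derB e k C) u = p-derB (plugged-plug C u)

size : ∀ {s Γ} → El s Γ → ℕ
size {T} t = sizeT t
size {V} v = sizeV v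

plugged-size≤ : ∀ {s Γ Θ} {Q : Ctx s Γ V Θ} {w a} → Plugged Q w a → sizeV w ≤ size a
plugged-size≤ p-hole      = ≤-refl
plugged-size≤ (p-pairL p) = m≤n⇒m≤1+n (m≤n⇒m≤n+o _ (plugged-size≤ p))
plugged-size≤ (p-pairR p) = m≤n⇒m≤o+n (suc _) (plugged-size≤ p)
plugged-size≤ (p-lamC p)  = m≤n⇒m≤1+n (plugged-size≤ p)
plugged-size≤ (p-bangC p) = m≤n⇒m≤1+n (plugged-size≤ p)
plugged-size≤ (p-valC p)  = plugged-size≤ p
plugged-size≤ (p-cutV p)  = m≤n⇒m≤1+n (m≤n⇒m≤n+o _ (plugged-size≤ p))
plugged-size≤ (p-cutB p)  = m≤n⇒m≤o+n (suc _) (plugged-size≤ p)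
plugged-size≤ (p-parB p)  = m≤n⇒m≤1+n (plugged-size≤ p)
plugged-size≤ (p-subV p)  = m≤n⇒m≤1+n (m≤n⇒m≤n+o _ (plugged-size≤ p))
plugged-size≤ (p-subB p)  = m≤n⇒m≤o+n (suc _) (plugged-size≤ p)
plugged-size≤ (p-derB p)  = m≤n⇒m≤1+n (plugged-size≤ p)


SameVar-refl : ∀ {Γ k} (x : Γ ∋ k) → SameVar x x
SameVar-refl here = tt
SameVar-refl (there x) = SameVar-refl x

SameVar-subst : ∀ {Γ k k'} (x : Γ ∋ k) (y : Γ ∋ k') → SameVar x y →
          (P : ∀ {k} → Γ ∋ k → Set) → P y → P x
SameVar-subst here here s P p = p
SameVar-subst (there x) (there y) s P p = SameVar-subst x y s (λ z → P (there z)) p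

SameVar-ren : ∀ {Γ Δ} (ρ : Ren Γ Δ) {k k'} (x : Γ ∋ k) (y : Γ ∋ k') → SameVar x y → SameVar (ρ x) (ρ y)
SameVar-ren ρ x y s = SameVar-subst x y s (λ z → SameVar (ρ z) (ρ y)) (SameVar-refl (ρ y))

there-injective : ∀ {Γ k k'} {x y : Γ ∋ k} → there {k' = k'} x ≡ there y → x ≡ y
there-injective refl = refl

ren : ∀ {s Γ Δ} → Ren Γ Δ → El s Γ → El s Δ
ren {T} ρ t = renT ρ t
ren {V} ρ v = renV ρ v

sizeV-renV : ∀ {Γ Δ} (ρ : Ren Γ Δ) (v : Val Γ) → sizeV (renV ρ v) ≡ sizeV v
sizeT-renT : ∀ {Γ Δ} (ρ : Ren Γ Δ) (t : Tm Γ) → sizeT (renT ρ t) ≡ sizeT t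
sizeV-renV ρ (mvar x) = refl
sizeV-renV ρ (pair t s) = cong suc (cong₂ _+_ (sizeT-renT ρ t) (sizeT-renT ρ s))
sizeV-renV ρ (lam k t) = cong suc (sizeT-renT (ext ρ) t)
sizeV-renV ρ (evar x) = refl
sizeV-renV ρ (bang t) = cong suc (sizeT-renT ρ t)
sizeT-renT ρ (val v) = sizeV-renV ρ v
sizeT-renT ρ (cut k v t) = cong suc (cong₂ _+_ (sizeV-renV ρ v) (sizeT-renT (ext ρ) t))
sizeT-renT ρ (par m k₁ k₂ t) = cong suc (sizeT-renT (ext (ext ρ)) t)
sizeT-renT ρ (sub m v k t) = cong suc (cong₂ _+_ (sizeV-renV ρ v) (sizeT-renT (ext ρ) t))
sizeT-renT ρ (der e k t) = cong suc (sizeT-renT (ext ρ) t)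

plugged-ren : ∀ {s Γ Δ Θ} (ρ : Ren Γ Δ) {Q : Ctx s Γ V Θ} {w a} → Plugged Q w a →
         Plugged (renC ρ Q) (renV (liftΘ Θ ρ) w) (ren ρ a)
plugged-ren ρ p-hole = p-hole
plugged-ren ρ (p-pairL p) = p-pairL (plugged-ren ρ p)
plugged-ren ρ (p-pairR p) = p-pairR (plugged-ren ρ p)
plugged-ren ρ (p-lamC p) = p-lamC (plugged-ren (ext ρ) p)
plugged-ren ρ (p-bangC p) = p-bangC (plugged-ren ρ p)
plugged-ren ρ (p-valC p) = p-valC (plugged-ren ρ p)
plugged-ren ρ (p-cutV p) = p-cutV (plugged-ren ρ p)
plugged-ren ρ (p-cutB p) = p-cutB (plugged-ren (ext ρ) p)
plugged-ren ρ (p-parB p) = p-parB (plugged-ren (ext (ext ρ)) p)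
plugged-ren ρ (p-subV p) = p-subV (plugged-ren ρ p)
plugged-ren ρ (p-subB p) = p-subB (plugged-ren (ext ρ) p)
plugged-ren ρ (p-derB p) = p-derB (plugged-ren (ext ρ) p)

record RenamedOccurrence {s Γ Δ Θ} (ρ : Ren Γ Δ) (a : El s Γ) (Q : Ctx s Δ V Θ)
                         (w : Val (Θ ⋈ Δ)) : Set where
  constructor renamedOcc
  field
    Q₀       : Ctx s Γ V Θ
    w₀       : Val (Θ ⋈ Γ)
    plugged₀ : Plugged Q₀ w₀ a
    Q≡       : Q ≡ renC ρ Q₀
    w≡       : w ≡ renV (liftΘ Θ ρ) w₀

plugged-renV⁻¹ : ∀ {Γ Δ Θ} (ρ : Ren Γ Δ) (a : Val Γ) {Q : Ctx V Δ V Θ} {w} →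
                 Plugged Q w (renV ρ a) → RenamedOccurrence ρ a Q w
plugged-renT⁻¹ : ∀ {Γ Δ Θ} (ρ : Ren Γ Δ) (a : Tm Γ) {Q : Ctx T Δ V Θ} {w} →
                 Plugged Q w (renT ρ a) → RenamedOccurrence ρ a Q w
plugged-renV⁻¹ ρ (mvar x)   p-hole = renamedOcc hole (mvar x) p-hole refl refl
plugged-renV⁻¹ ρ (evar x)   p-hole = renamedOcc hole (evar x) p-hole refl refl
plugged-renV⁻¹ ρ (pair t s) p-hole = renamedOcc hole (pair t s) p-hole refl refl
plugged-renV⁻¹ ρ (lam k t)  p-hole = renamedOcc hole (lam k t) p-hole refl refl
plugged-renV⁻¹ ρ (bang t)   p-hole = renamedOcc hole (bang t) p-hole refl refl
plugged-renV⁻¹ ρ (pair t s) (p-pairL p) with plugged-renT⁻¹ ρ t p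
... | renamedOcc Q w p₀ refl w≡ = renamedOcc (pairL Q s) w (p-pairL p₀) refl w≡
plugged-renV⁻¹ ρ (pair t s) (p-pairR p) with plugged-renT⁻¹ ρ s p
... | renamedOcc Q w p₀ refl w≡ = renamedOcc (pairR t Q) w (p-pairR p₀) refl w≡
plugged-renV⁻¹ ρ (lam k t) (p-lamC p) with plugged-renT⁻¹ (ext ρ) t p
... | renamedOcc Q w p₀ refl w≡ = renamedOcc (lamC k Q) w (p-lamC p₀) refl w≡
plugged-renV⁻¹ ρ (bang t) (p-bangC p) with plugged-renT⁻¹ ρ t p
... | renamedOcc Q w p₀ refl w≡ = renamedOcc (bangC Q) w (p-bangC p₀) refl w≡
plugged-renT⁻¹ ρ (val v) (p-valC p) with plugged-renV⁻¹ ρ v p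
... | renamedOcc Q w p₀ refl w≡ = renamedOcc (valC Q) w (p-valC p₀) refl w≡
plugged-renT⁻¹ ρ (cut k v t) (p-cutV p) with plugged-renV⁻¹ ρ v p
... | renamedOcc Q w p₀ refl w≡ = renamedOcc (cutV k Q t) w (p-cutV p₀) refl w≡
plugged-renT⁻¹ ρ (cut k v t) (p-cutB p) with plugged-renT⁻¹ (ext ρ) t p
... | renamedOcc Q w p₀ refl w≡ = renamedOcc (cutB k v Q) w (p-cutB p₀) refl w≡
plugged-renT⁻¹ ρ (par m k₁ k₂ t) (p-parB p) with plugged-renT⁻¹ (ext (ext ρ)) t p
... | renamedOcc Q w p₀ refl w≡ = renamedOcc (parB m k₁ k₂ Q) w (p-parB p₀) refl w≡
plugged-renT⁻¹ ρ (sub m v k t) (p-subV p) with plugged-renV⁻¹ ρ v p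
... | renamedOcc Q w p₀ refl w≡ = renamedOcc (subV m Q k t) w (p-subV p₀) refl w≡
plugged-renT⁻¹ ρ (sub m v k t) (p-subB p) with plugged-renT⁻¹ (ext ρ) t p
... | renamedOcc Q w p₀ refl w≡ = renamedOcc (subB m v k Q) w (p-subB p₀) refl w≡
plugged-renT⁻¹ ρ (der e k t) (p-derB p) with plugged-renT⁻¹ (ext ρ) t p
... | renamedOcc Q w p₀ refl w≡ = renamedOcc (derB e k Q) w (p-derB p₀) refl w≡

∈dfv-renC : ∀ {s Γ Δ s' Θ} (ρ : Ren Γ Δ) (Q : Ctx s Γ s' Θ) {k} (x : Γ ∋ k) →
            x ∈dfv Q → ρ x ∈dfv renC ρ Q
∈dfv-renC ρ (pairL Q t)      x h = ∈dfv-renC ρ Q x h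
∈dfv-renC ρ (pairR t Q)      x h = ∈dfv-renC ρ Q x h
∈dfv-renC ρ (lamC k Q)       x h = ∈dfv-renC (ext ρ) Q (there x) h
∈dfv-renC ρ (bangC Q)        x h = ∈dfv-renC ρ Q x h
∈dfv-renC ρ (valC Q)         x h = ∈dfv-renC ρ Q x h
∈dfv-renC ρ (cutV k Q t)     x h = ∈dfv-renC ρ Q x h
∈dfv-renC ρ (cutB k v Q)     x h = ∈dfv-renC (ext ρ) Q (there x) h
∈dfv-renC ρ (parB m k₁ k₂ Q) x (inj₁ h) = inj₁ (∈dfv-renC (ext (ext ρ)) Q (there (there x)) h)
∈dfv-renC ρ (parB m k₁ k₂ Q) x (inj₂ (sv , inj₁ h)) =
  inj₂ (SameVar-ren ρ x m sv , inj₁ (∈dfv-renC (ext (ext ρ)) Q here h))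
∈dfv-renC ρ (parB m k₁ k₂ Q) x (inj₂ (sv , inj₂ h)) =
  inj₂ (SameVar-ren ρ x m sv , inj₂ (∈dfv-renC (ext (ext ρ)) Q (there here) h))
∈dfv-renC ρ (subV m Q k t) x (inj₁ sv)       = inj₁ (SameVar-ren ρ x m sv)
∈dfv-renC ρ (subV m Q k t) x (inj₂ h)        = inj₂ (∈dfv-renC ρ Q x h)
∈dfv-renC ρ (subB m v k Q) x (inj₁ h)        = inj₁ (∈dfv-renC (ext ρ) Q (there x) h)
∈dfv-renC ρ (subB m v k Q) x (inj₂ (sv , h)) = inj₂ (SameVar-ren ρ x m sv , ∈dfv-renC (ext ρ) Q here h)
∈dfv-renC ρ (derB e k Q)   x (inj₁ h)        = inj₁ (∈dfv-renC (ext ρ) Q (there x) h)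
∈dfv-renC ρ (derB e k Q)   x (inj₂ (sv , h)) = inj₂ (SameVar-ren ρ x e sv , ∈dfv-renC (ext ρ) Q here h)

DfvPreimage : ∀ {s Γ Δ s' Θ} (ρ : Ren Γ Δ) (Q : Ctx s Γ s' Θ) {k} (y : Δ ∋ k) → Set
DfvPreimage {Γ = Γ} ρ Q {k} y = Σ (Γ ∋ k) λ x → x ∈dfv Q × ρ x ≡ y

ext-preimage-here : ∀ {Γ Δ k0} (ρ : Ren Γ Δ) (P : (k0 ∷ Γ) ∋ k0 → Set) →
                    Σ ((k0 ∷ Γ) ∋ k0) (λ x → P x × ext ρ x ≡ here) → P here
ext-preimage-here ρ P (here , p , _) = p

ext-preimage-there : ∀ {Γ Δ k0 k} (ρ : Ren Γ Δ) (P : (k0 ∷ Γ) ∋ k → Set) (y : Δ ∋ k) →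
                     Σ ((k0 ∷ Γ) ∋ k) (λ x → P x × ext ρ x ≡ there y) →
                     Σ (Γ ∋ k) λ x → P (there x) × ρ x ≡ y
ext-preimage-there ρ P y (there x , p , e) = x , p , there-injective e

∈dfv-renC⁻¹ : ∀ {s Γ Δ s' Θ} (ρ : Ren Γ Δ) (Q : Ctx s Γ s' Θ) {k} (y : Δ ∋ k) →
              y ∈dfv renC ρ Q → DfvPreimage ρ Q y
∈dfv-renC⁻¹ ρ (pairL Q t)  y h = ∈dfv-renC⁻¹ ρ Q y h
∈dfv-renC⁻¹ ρ (pairR t Q)  y h = ∈dfv-renC⁻¹ ρ Q y h
∈dfv-renC⁻¹ ρ (lamC k Q)   y h = ext-preimage-there ρ (_∈dfv Q) y (∈dfv-renC⁻¹ (ext ρ) Q (there y) h)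
∈dfv-renC⁻¹ ρ (bangC Q)    y h = ∈dfv-renC⁻¹ ρ Q y h
∈dfv-renC⁻¹ ρ (valC Q)     y h = ∈dfv-renC⁻¹ ρ Q y h
∈dfv-renC⁻¹ ρ (cutV k Q t) y h = ∈dfv-renC⁻¹ ρ Q y h
∈dfv-renC⁻¹ ρ (cutB k v Q) y h = ext-preimage-there ρ (_∈dfv Q) y (∈dfv-renC⁻¹ (ext ρ) Q (there y) h)
∈dfv-renC⁻¹ ρ (parB m k₁ k₂ Q) y (inj₁ h) =
  let (x , d , e) = ext-preimage-there ρ (λ z → there z ∈dfv Q) y
                      (ext-preimage-there (ext ρ) (_∈dfv Q) (there y)
                        (∈dfv-renC⁻¹ (ext (ext ρ)) Q (there (there y)) h))
  in x , inj₁ d , e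
∈dfv-renC⁻¹ ρ (parB m k₁ k₂ Q) y (inj₂ (sv , inj₁ h)) =
  SameVar-subst y (ρ m) sv (DfvPreimage ρ (parB m _ _ Q))
    (m , inj₂ (SameVar-refl m , inj₁ (ext-preimage-here (ext ρ) (_∈dfv Q)
                                        (∈dfv-renC⁻¹ (ext (ext ρ)) Q here h))) , refl)
∈dfv-renC⁻¹ ρ (parB m k₁ k₂ Q) y (inj₂ (sv , inj₂ h)) =
  SameVar-subst y (ρ m) sv (DfvPreimage ρ (parB m _ _ Q))
    (m , inj₂ (SameVar-refl m , inj₂ (ext-preimage-here ρ (λ z → there z ∈dfv Q)
                                        (ext-preimage-there (ext ρ) (_∈dfv Q) here
                                          (∈dfv-renC⁻¹ (ext (ext ρ)) Q (there here) h)))) , refl)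
∈dfv-renC⁻¹ ρ (subV m Q k t) y (inj₁ sv) =
  SameVar-subst y (ρ m) sv (DfvPreimage ρ (subV m Q k t)) (m , inj₁ (SameVar-refl m) , refl)
∈dfv-renC⁻¹ ρ (subV m Q k t) y (inj₂ h) =
  let (x , d , e) = ∈dfv-renC⁻¹ ρ Q y h in x , inj₂ d , e
∈dfv-renC⁻¹ ρ (subB m v k Q) y (inj₁ h) =
  let (x , d , e) = ext-preimage-there ρ (_∈dfv Q) y (∈dfv-renC⁻¹ (ext ρ) Q (there y) h) in x , inj₁ d , e
∈dfv-renC⁻¹ ρ (subB m v k Q) y (inj₂ (sv , h)) =
  SameVar-subst y (ρ m) sv (DfvPreimage ρ (subB m v k Q))
    (m , inj₂ (SameVar-refl m , ext-preimage-here ρ (_∈dfv Q) (∈dfv-renC⁻¹ (ext ρ) Q here h)) , refl)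
∈dfv-renC⁻¹ ρ (derB e k Q) y (inj₁ h) =
  let (x , d , eq) = ext-preimage-there ρ (_∈dfv Q) y (∈dfv-renC⁻¹ (ext ρ) Q (there y) h) in x , inj₁ d , eq
∈dfv-renC⁻¹ ρ (derB e k Q) y (inj₂ (sv , h)) =
  SameVar-subst y (ρ e) sv (DfvPreimage ρ (derB e k Q))
    (e , inj₂ (SameVar-refl e , ext-preimage-here ρ (_∈dfv Q) (∈dfv-renC⁻¹ (ext ρ) Q here h)) , refl)

Good-renC⁻¹ : ∀ {s Γ Δ s' Θ} (ρ : Ren Γ Δ) (Q : Ctx s Γ s' Θ) → Good (renC ρ Q) → Good Q
Good-renC⁻¹ ρ hole             g = tt
Good-renC⁻¹ ρ (pairL Q t)      g = Good-renC⁻¹ ρ Q g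
Good-renC⁻¹ ρ (pairR t Q)      g = Good-renC⁻¹ ρ Q g
Good-renC⁻¹ ρ (lamC k Q)       g = Good-renC⁻¹ (ext ρ) Q g
Good-renC⁻¹ ρ (bangC Q)        g = Good-renC⁻¹ ρ Q g
Good-renC⁻¹ ρ (valC Q)         g = Good-renC⁻¹ ρ Q g
Good-renC⁻¹ ρ (cutB k v Q) (g , n) = Good-renC⁻¹ (ext ρ) Q g , λ h → n (∈dfv-renC (ext ρ) Q here h)
Good-renC⁻¹ ρ (parB m k₁ k₂ Q) g = Good-renC⁻¹ (ext (ext ρ)) Q g
Good-renC⁻¹ ρ (subV m Q k t)   g = Good-renC⁻¹ ρ Q g
Good-renC⁻¹ ρ (subB m v k Q)   g = Good-renC⁻¹ (ext ρ) Q g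
Good-renC⁻¹ ρ (derB e k Q)     g = Good-renC⁻¹ (ext ρ) Q g

Good-renC : ∀ {s Γ Δ s' Θ} (ρ : Ren Γ Δ) (Q : Ctx s Γ s' Θ) → Good Q → Good (renC ρ Q)
Good-renC ρ hole             g = tt
Good-renC ρ (pairL Q t)      g = Good-renC ρ Q g
Good-renC ρ (pairR t Q)      g = Good-renC ρ Q g
Good-renC ρ (lamC k Q)       g = Good-renC (ext ρ) Q g
Good-renC ρ (bangC Q)        g = Good-renC ρ Q g
Good-renC ρ (valC Q)         g = Good-renC ρ Q g
Good-renC ρ (cutB k v Q) (g , n) =
  Good-renC (ext ρ) Q g , λ h → n (ext-preimage-here ρ (_∈dfv Q) (∈dfv-renC⁻¹ (ext ρ) Q here h))
Good-renC ρ (parB m k₁ k₂ Q) g = Good-renC (ext (ext ρ)) Q g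
Good-renC ρ (subV m Q k t)   g = Good-renC ρ Q g
Good-renC ρ (subB m v k Q)   g = Good-renC (ext ρ) Q g
Good-renC ρ (derB e k Q)     g = Good-renC (ext ρ) Q g

-- A VarRel relates variables of the scope after a step to variables of the scope before it.
VarRel : Scope → Scope → Set₁
VarRel Δ Δ' = ∀ {k} → Δ ∋ k → Δ' ∋ k → Set

VarPred : Scope → Set₁
VarPred Δ = ∀ {k} → Δ ∋ k → Set

none : ∀ {Δ} → VarPred Δ
none _ = ⊥

extRel : ∀ {Δ Δ' k0} → VarRel Δ Δ' → VarRel (k0 ∷ Δ) (k0 ∷ Δ')
extRel R here      here      = ⊤
extRel R here      (there y) = ⊥
extRel R (there x) here      = ⊥
extRel R (there x) (there y) = R x y

weakRelˡ : ∀ {Δ Δ' k0} → VarRel Δ Δ' → VarRel (k0 ∷ Δ) Δ'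
weakRelˡ R here      y = ⊥
weakRelˡ R (there x) y = R x y

weakRelʳ : ∀ {Δ Δ' k0} → VarRel Δ Δ' → VarRel Δ (k0 ∷ Δ')
weakRelʳ R x here      = ⊥
weakRelʳ R x (there y) = R x y

cutPred : ∀ {Δ k0} → VarPred Δ → VarPred (k0 ∷ Δ)
cutPred P here      = ⊤
cutPred P (there y) = P y

weakPred : ∀ {Δ k0} → VarPred Δ → VarPred (k0 ∷ Δ)
weakPred P here      = ⊥
weakPred P (there y) = P y

DfvCovered : ∀ {s Δ Δ' s₁ Θ s₂ Θ'} → VarRel Δ Δ' → Ctx s Δ s₁ Θ → Ctx s Δ' s₂ Θ' → Set
DfvCovered {Δ = Δ} {Δ'} R Q Q' = ∀ {k} (x : Δ ∋ k) → x ∈dfv Q → Σ (Δ' ∋ k) λ y → R x y × y ∈dfv Q'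

Undominated : ∀ {s Δ' s' Θ'} → VarPred Δ' → Ctx s Δ' s' Θ' → Set
Undominated {Δ' = Δ'} P Q' = ∀ {k} (y : Δ' ∋ k) → P y → ¬ (y ∈dfv Q')

DfvWithin : ∀ {s Δ s' Θ} → Ctx s Δ s' Θ → VarPred Δ → Set
DfvWithin {Δ = Δ} Q d = ∀ {k} (x : Δ ∋ k) → x ∈dfv Q → d x

-- The occurrence of w at Q (after the step) descends from the occurrence of w' at Q' in a
-- (before the step).  P lists variables bound by cuts around a; a context that is good for
-- the whole term is not dominated by them, which is why reflect may assume Undominated P Q'.
record Origin {s Δ Δ'} (R : VarRel Δ Δ') (P : VarPred Δ') (a : El s Δ')
              {Θ} (Q : Ctx s Δ V Θ) (w : Val (Θ ⋈ Δ)) : Set where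
  constructor origin
  field
    {Θ'}    : List Kind
    Q'      : Ctx s Δ' V Θ'
    w'      : Val (Θ' ⋈ Δ')
    plugged : Plugged Q' w' a
    size≤   : sizeV w ≤ sizeV w'
    reflect : Good Q' → Undominated P Q' → Good Q × DfvCovered R Q Q'

-- The occurrence lies in the part built by the step: if that part sits at a good position
-- (g, seen from here), the occurrence is in a good context dominated only by variables in d.
Created : ∀ {s Δ} → Set → VarPred Δ → ∀ {Θ} → Ctx s Δ V Θ → Set
Created g d Q = g → Good Q × DfvWithin Q d

data Explained {s Δ Δ'} (R : VarRel Δ Δ') (P : VarPred Δ') (N : ℕ) (a : El s Δ')
               (g : Set) (d : VarPred Δ) {Θ} (Q : Ctx s Δ V Θ) (w : Val (Θ ⋈ Δ)) : Set where
  traced  : Origin R P a Q w → Explained R P N a g d Q w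
  created : Created g d Q → Explained R P N a g d Q w
  small   : sizeV w ≤ N → Explained R P N a g d Q w

Explains : (s : Sort) {Δ Δ' : Scope} → VarRel Δ Δ' → VarPred Δ' → ℕ → El s Δ' → El s Δ →
           Set → VarPred Δ → Set
Explains s {Δ} R P N a b g d =
  ∀ {Θ} (Q : Ctx s Δ V Θ) (w : Val (Θ ⋈ Δ)) → Plugged Q w b → Explained R P N a g d Q w

Mirrors : (s : Sort) {Δ Δ' : Scope} → VarRel Δ Δ' → El s Δ' → El s Δ → Set
Mirrors s {Δ} R a b = ∀ {Θ} (Q : Ctx s Δ V Θ) (w : Val (Θ ⋈ Δ)) → Plugged Q w b → Origin R none a Q w

origin-none : ∀ {s Δ Δ'} {R : VarRel Δ Δ'} {P : VarPred Δ'} {a : El s Δ'} {Θ} {Q : Ctx s Δ V Θ} {w} →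
              Origin R none a Q w → Origin R P a Q w
origin-none (origin Q' w' pl sz ok) = origin Q' w' pl sz (λ g _ → ok g (λ _ ()))

origin-mono : ∀ {s Δ Δ'} {R R' : VarRel Δ Δ'} {P P' : VarPred Δ'} {a : El s Δ'} {Θ}
              {Q : Ctx s Δ V Θ} {w} →
              (∀ {k} (x : Δ ∋ k) y → R x y → R' x y) → (∀ {k} (y : Δ' ∋ k) → P y → P' y) →
              Origin R P a Q w → Origin R' P' a Q w
origin-mono RR PP (origin Q' w' pl sz ok) = origin Q' w' pl sz λ g np →
  let (gq , cov) = ok g (λ y py → np y (PP y py)) in
  gq , λ x h → let (y , r , d) = cov x h in y , RR x y r , d

explains-mono : ∀ {s Δ Δ'} {R R' : VarRel Δ Δ'} {P P' : VarPred Δ'} {N N' a b g g'}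
                {d d' : VarPred Δ} →
                (∀ {k} (x : Δ ∋ k) y → R x y → R' x y) → (∀ {k} (y : Δ' ∋ k) → P y → P' y) →
                N ≤ N' → (g' → g) → (∀ {k} (x : Δ ∋ k) → d x → d' x) →
                Explains s R P N a b g d → Explains s R' P' N' a b g' d'
explains-mono RR PP NN gg dd e Q w p with e Q w p
... | traced o  = traced (origin-mono RR PP o)
... | created k = created λ g → let (gq , within) = k (gg g) in gq , λ x h → dd x (within x h)
... | small n   = small (≤-trans n NN)

explains-small : ∀ {s Δ Δ'} {R : VarRel Δ Δ'} {P : VarPred Δ'} {N a g} {d : VarPred Δ}
                 (b : El s Δ) → size b ≤ N → Explains s R P N a b g d
explains-small b h Q w p = small (≤-trans (plugged-size≤ p) h)

extRel-here : ∀ {Δ Δ' k0} {R : VarRel Δ Δ'} (Pd : (k0 ∷ Δ') ∋ k0 → Set) →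
              Σ ((k0 ∷ Δ') ∋ k0) (λ y → extRel R here y × Pd y) → Pd here
extRel-here Pd (here , _ , d) = d

extRel-there : ∀ {Δ Δ' k0 k} {R : VarRel Δ Δ'} {x : Δ ∋ k} (Pd : (k0 ∷ Δ') ∋ k → Set) →
               Σ ((k0 ∷ Δ') ∋ k) (λ y → extRel R (there x) y × Pd y) →
               Σ (Δ' ∋ k) λ y → R x y × Pd (there y)
extRel-there Pd (there y , r , d) = y , r , d

DfvImage : ∀ {s Δ Δ' s' Θ'} → VarRel Δ Δ' → Ctx s Δ' s' Θ' → VarPred Δ
DfvImage {Δ' = Δ'} R F {k} x = Σ (Δ' ∋ k) λ y → R x y × y ∈dfv F

covered-binder : ∀ {Δ Δ' k0 s Θ Θ' s₁ s₂ s₃ Θ₁ Θ₂} {R : VarRel Δ Δ'}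
                 {Q : Ctx T (k0 ∷ Δ) s Θ} {Q' : Ctx T (k0 ∷ Δ') s Θ'}
                 {F : Ctx s₁ Δ s₂ Θ₁} {F' : Ctx s₁ Δ' s₃ Θ₂} →
                 (∀ {k} (x : Δ ∋ k) → x ∈dfv F → there x ∈dfv Q) →
                 (∀ {k} (y : Δ' ∋ k) → there y ∈dfv Q' → y ∈dfv F') →
                 DfvCovered (extRel R) Q Q' → DfvCovered R F F'
covered-binder {Q' = Q'} into out cov x h =
  let (y , r , d) = extRel-there (_∈dfv Q') (cov (there x) (into x h)) in y , r , out y d

undominated-binder : ∀ {Δ' k0 s Θ' s₁ s₂ Θ₁} {P : VarPred Δ'}
                     {Q' : Ctx T (k0 ∷ Δ') s Θ'} {F : Ctx s₁ Δ' s₂ Θ₁} →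
                     (∀ {k} (y : Δ' ∋ k) → there y ∈dfv Q' → y ∈dfv F) →
                     Undominated P F → Undominated (weakPred P) Q'
undominated-binder f np (there y) py d = np y py (f y d)

covered-bound : ∀ {Δ Δ' k0 s Θ Θ' km} {R : VarRel Δ Δ'} {m : Δ ∋ km} {m' : Δ' ∋ km}
                {Q : Ctx T (k0 ∷ Δ) s Θ} {Q' : Ctx T (k0 ∷ Δ') s Θ'} →
                R m m' → DfvCovered (extRel R) Q Q' →
                ∀ {k} (x : Δ ∋ k) → (there x ∈dfv Q) ⊎ (SameVar x m × (here ∈dfv Q)) →
                Σ (Δ' ∋ k) λ y → R x y × ((there y ∈dfv Q') ⊎ (SameVar y m' × (here ∈dfv Q')))
covered-bound {Q' = Q'} rm cov x (inj₁ h) =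
  let (y , r , d) = extRel-there (_∈dfv Q') (cov (there x) h) in y , r , inj₁ d
covered-bound {R = R} {m} {m'} {Q' = Q'} rm cov x (inj₂ (sv , h)) =
  SameVar-subst x m sv (λ z → Σ _ λ y → R z y × ((there y ∈dfv Q') ⊎ (SameVar y m' × (here ∈dfv Q'))))
    (m' , rm , inj₂ (SameVar-refl m' , extRel-here (_∈dfv Q') (cov here h)))

module _ {Δ Δ' : Scope} {R : VarRel Δ Δ'} {P : VarPred Δ'} where

  origin-pairL : ∀ {Θ} {a t' t} {Q : Ctx T Δ V Θ} {w} →
                 Origin R P a Q w → Origin R P (pair a t') (pairL Q t) w
  origin-pairL (origin Q' w' pl sz ok) = origin (pairL Q' _) w' (p-pairL pl) sz ok

  origin-pairR : ∀ {Θ} {a t' t} {Q : Ctx T Δ V Θ} {w} →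
                 Origin R P a Q w → Origin R P (pair t' a) (pairR t Q) w
  origin-pairR (origin Q' w' pl sz ok) = origin (pairR _ Q') w' (p-pairR pl) sz ok

  origin-bang : ∀ {Θ} {a} {Q : Ctx T Δ V Θ} {w} →
                Origin R P a Q w → Origin R P (bang a) (bangC Q) w
  origin-bang (origin Q' w' pl sz ok) = origin (bangC Q') w' (p-bangC pl) sz ok

  origin-val : ∀ {Θ} {a} {Q : Ctx V Δ V Θ} {w} →
               Origin R P a Q w → Origin R P (val a) (valC Q) w
  origin-val (origin Q' w' pl sz ok) = origin (valC Q') w' (p-valC pl) sz ok

  origin-cutV : ∀ {Θ k} {a t' t} {Q : Ctx V Δ V Θ} {w} →
                Origin R P a Q w → Origin R P (cut k a t') (cutV k Q t) w
  origin-cutV (origin Q' w' pl sz ok) = origin (cutV _ Q' _) w' (p-cutV pl) sz (λ ())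

  origin-subV : ∀ {Θ k} {m : Δ ∋ 𝕞} {m' : Δ' ∋ 𝕞} {a t' t} {Q : Ctx V Δ V Θ} {w} →
                R m m' → Origin R P a Q w → Origin R P (sub m' a k t') (subV m Q k t) w
  origin-subV {k = k} {m = m} {m'} {t' = t'} rm (origin Q' w' pl sz ok) =
    origin (subV m' Q' k t') w' (p-subV pl) sz λ g np →
      let (gq , cov) = ok g (λ y py d → np y py (inj₂ d)) in
      gq , λ { x (inj₁ sv) → SameVar-subst x m sv (DfvImage R (subV m' Q' k t'))
                               (m' , rm , inj₁ (SameVar-refl m'))
             ; x (inj₂ h)  → let (y , r , d) = cov x h in y , r , inj₂ d }

  origin-lam : ∀ {Θ k} {a} {Q : Ctx T (k ∷ Δ) V Θ} {w} →
               Origin (extRel R) (weakPred P) a Q w → Origin R P (lam k a) (lamC k Q) w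
  origin-lam {k = k} {Q = Q} (origin Q' w' pl sz ok) =
    origin (lamC k Q') w' (p-lamC pl) sz λ g np →
      let (gq , cov) = ok g (undominated-binder {Q' = Q'} {F = lamC k Q'} (λ _ d → d) np) in
      gq , covered-binder {Q = Q} {Q'} {F = lamC k Q} {F' = lamC k Q'} (λ _ h → h) (λ _ d → d) cov

  origin-cutB : ∀ {Θ k} {a v' v} {Q : Ctx T (k ∷ Δ) V Θ} {w} →
                Origin (extRel R) (cutPred P) a Q w → Origin R P (cut k v' a) (cutB k v Q) w
  origin-cutB {k = k} {v' = v'} {v} {Q = Q} (origin Q' w' pl sz ok) =
    origin (cutB k v' Q') w' (p-cutB pl) sz λ { (gq' , nh) np →
      let (gq , cov) = ok gq' (λ { here _ → nh ; (there y) py d → np y py d }) in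
      (gq , λ h → nh (extRel-here (_∈dfv Q') (cov here h))) ,
      covered-binder {Q = Q} {Q'} {F = cutB k v Q} {F' = cutB k v' Q'} (λ _ h → h) (λ _ d → d) cov }

  origin-par : ∀ {Θ k₁ k₂} {m : Δ ∋ 𝕞} {m' : Δ' ∋ 𝕞} {a}
               {Q : Ctx T (k₂ ∷ k₁ ∷ Δ) V Θ} {w} →
               R m m' → Origin (extRel (extRel R)) (weakPred (weakPred P)) a Q w →
               Origin R P (par m' k₁ k₂ a) (parB m k₁ k₂ Q) w
  origin-par {m = m} {m'} rm (origin Q' w' pl sz ok) =
    origin (parB m' _ _ Q') w' (p-parB pl) sz λ g np →
      let (gq , cov) = ok g (λ { (there (there y)) py d → np y py (inj₁ d) }) in
      gq , λ { x (inj₁ h) →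
                 let (y₁ , r₁ , d₁) = extRel-there (_∈dfv Q') (cov (there (there x)) h)
                     (y , r , d) = extRel-there (λ y → there y ∈dfv Q') (y₁ , r₁ , d₁)
                 in y , r , inj₁ d
             ; x (inj₂ (sv , inj₁ h)) →
                 SameVar-subst x m sv (DfvImage R (parB m' _ _ Q'))
                   (m' , rm , inj₂ (SameVar-refl m' , inj₁ (extRel-here (_∈dfv Q') (cov here h))))
             ; x (inj₂ (sv , inj₂ h)) →
                 SameVar-subst x m sv (DfvImage R (parB m' _ _ Q'))
                   (m' , rm , inj₂ (SameVar-refl m' , inj₂ (extRel-here (λ y → there y ∈dfv Q')
                     (extRel-there (_∈dfv Q') (cov (there here) h))))) }

  origin-subB : ∀ {Θ k} {m : Δ ∋ 𝕞} {m' : Δ' ∋ 𝕞} {a v' v} {Q : Ctx T (k ∷ Δ) V Θ} {w} →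
                R m m' → Origin (extRel R) (weakPred P) a Q w →
                Origin R P (sub m' v' k a) (subB m v k Q) w
  origin-subB {k = k} {m' = m'} {v' = v'} {Q = Q} rm (origin Q' w' pl sz ok) =
    origin (subB m' v' k Q') w' (p-subB pl) sz λ g np →
      let (gq , cov) = ok g (undominated-binder {Q' = Q'} {F = subB m' v' k Q'} (λ _ d → inj₁ d) np) in
      gq , covered-bound {Q = Q} {Q'} rm cov

  origin-der : ∀ {Θ k} {e : Δ ∋ 𝕖} {e' : Δ' ∋ 𝕖} {a} {Q : Ctx T (k ∷ Δ) V Θ} {w} →
               R e e' → Origin (extRel R) (weakPred P) a Q w →
               Origin R P (der e' k a) (derB e k Q) w
  origin-der {k = k} {e' = e'} {Q = Q} re (origin Q' w' pl sz ok) =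
    origin (derB e' k Q') w' (p-derB pl) sz λ g np →
      let (gq , cov) = ok g (undominated-binder {Q' = Q'} {F = derB e' k Q'} (λ _ d → inj₁ d) np) in
      gq , covered-bound {Q = Q} {Q'} re cov

-- Correspond R E' E: the contexts E' (before) and E (after) have the same shape, their
-- variables are related by R, and corresponding siblings of the hole mirror each other.
data Correspond : ∀ {Δ Δ'} → VarRel Δ Δ' → ∀ {s s' Θ} → Ctx s Δ' s' Θ → Ctx s Δ s' Θ → Set₁ where
  chole  : ∀ {Δ Δ' s} {R : VarRel Δ Δ'} → Correspond R {s} {s} hole hole
  cpairL : ∀ {Δ Δ' s Θ} {R : VarRel Δ Δ'} {E' : Ctx T Δ' s Θ} {E : Ctx T Δ s Θ} {t' t} →
           Correspond R E' E → Mirrors T R t' t → Correspond R (pairL E' t') (pairL E t)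
  cpairR : ∀ {Δ Δ' s Θ} {R : VarRel Δ Δ'} {E' : Ctx T Δ' s Θ} {E : Ctx T Δ s Θ} {t' t} →
           Mirrors T R t' t → Correspond R E' E → Correspond R (pairR t' E') (pairR t E)
  clamC  : ∀ {Δ Δ' s Θ k} {R : VarRel Δ Δ'} {E' : Ctx T (k ∷ Δ') s Θ} {E : Ctx T (k ∷ Δ) s Θ} →
           Correspond (extRel R) E' E → Correspond R (lamC k E') (lamC k E)
  cbangC : ∀ {Δ Δ' s Θ} {R : VarRel Δ Δ'} {E' : Ctx T Δ' s Θ} {E : Ctx T Δ s Θ} →
           Correspond R E' E → Correspond R (bangC E') (bangC E)
  cvalC  : ∀ {Δ Δ' s Θ} {R : VarRel Δ Δ'} {E' : Ctx V Δ' s Θ} {E : Ctx V Δ s Θ} →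
           Correspond R E' E → Correspond R (valC E') (valC E)
  ccutV  : ∀ {Δ Δ' s Θ k} {R : VarRel Δ Δ'} {E' : Ctx V Δ' s Θ} {E : Ctx V Δ s Θ} {t' t} →
           Correspond R E' E → Mirrors T (extRel R) t' t → Correspond R (cutV k E' t') (cutV k E t)
  ccutB  : ∀ {Δ Δ' s Θ k} {R : VarRel Δ Δ'} {E' : Ctx T (k ∷ Δ') s Θ} {E : Ctx T (k ∷ Δ) s Θ}
           {v' v} →
           Mirrors V R v' v → Correspond (extRel R) E' E → Correspond R (cutB k v' E') (cutB k v E)
  cparB  : ∀ {Δ Δ' s Θ k₁ k₂} {R : VarRel Δ Δ'} {E' : Ctx T (k₂ ∷ k₁ ∷ Δ') s Θ}
           {E : Ctx T (k₂ ∷ k₁ ∷ Δ) s Θ} {m m'} →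
           R m m' → Correspond (extRel (extRel R)) E' E →
           Correspond R (parB m' k₁ k₂ E') (parB m k₁ k₂ E)
  csubV  : ∀ {Δ Δ' s Θ k} {R : VarRel Δ Δ'} {E' : Ctx V Δ' s Θ} {E : Ctx V Δ s Θ} {m m' t' t} →
           R m m' → Correspond R E' E → Mirrors T (extRel R) t' t →
           Correspond R (subV m' E' k t') (subV m E k t)
  csubB  : ∀ {Δ Δ' s Θ k} {R : VarRel Δ Δ'} {E' : Ctx T (k ∷ Δ') s Θ} {E : Ctx T (k ∷ Δ) s Θ}
           {m m' v' v} →
           R m m' → Mirrors V R v' v → Correspond (extRel R) E' E →
           Correspond R (subB m' v' k E') (subB m v k E)
  cderB  : ∀ {Δ Δ' s Θ k} {R : VarRel Δ Δ'} {E' : Ctx T (k ∷ Δ') s Θ} {E : Ctx T (k ∷ Δ) s Θ}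
           {e e'} →
           R e e' → Correspond (extRel R) E' E → Correspond R (derB e' k E') (derB e k E)

holeRel : ∀ {Δ Δ'} {R : VarRel Δ Δ'} {s s' Θ} {E' : Ctx s Δ' s' Θ} {E : Ctx s Δ s' Θ} →
          Correspond R E' E → VarRel (Θ ⋈ Δ) (Θ ⋈ Δ')
holeRel {R = R} chole = R
holeRel (cpairL c _)  = holeRel c
holeRel (cpairR _ c)  = holeRel c
holeRel (clamC c)     = holeRel c
holeRel (cbangC c)    = holeRel c
holeRel (cvalC c)     = holeRel c
holeRel (ccutV c _)   = holeRel c
holeRel (ccutB _ c)   = holeRel c
holeRel (cparB _ c)   = holeRel c
holeRel (csubV _ c _) = holeRel c
holeRel (csubB _ _ c) = holeRel c
holeRel (cderB _ c)   = holeRel c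

-- Variables bound by the cuts of E' join P: a good context through such a cut is not
-- dominated by its variable.
holePred : ∀ {Δ Δ'} {R : VarRel Δ Δ'} {s s' Θ} {E' : Ctx s Δ' s' Θ} {E : Ctx s Δ s' Θ} →
           Correspond R E' E → VarPred Δ' → VarPred (Θ ⋈ Δ')
holePred chole         P = P
holePred (cpairL c _)  P = holePred c P
holePred (cpairR _ c)  P = holePred c P
holePred (clamC c)     P = holePred c (weakPred P)
holePred (cbangC c)    P = holePred c P
holePred (cvalC c)     P = holePred c P
holePred (ccutV c _)   P = holePred c P
holePred (ccutB _ c)   P = holePred c (cutPred P)
holePred (cparB _ c)   P = holePred c (weakPred (weakPred P))
holePred (csubV _ c _) P = holePred c P
holePred (csubB _ _ c) P = holePred c (weakPred P)
holePred (cderB _ c)   P = holePred c (weakPred P)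

-- Good and dfv of E composed with a context whose goodness is g and whose dominating free
-- variables are d.
GoodPlug : ∀ {s Δ s' Θ} → Ctx s Δ s' Θ → Set → VarPred (Θ ⋈ Δ) → Set
DfvPlug : ∀ {s Δ s' Θ} → Ctx s Δ s' Θ → VarPred (Θ ⋈ Δ) → VarPred Δ
GoodPlug hole g d = g
GoodPlug (pairL E t) g d = GoodPlug E g d
GoodPlug (pairR t E) g d = GoodPlug E g d
GoodPlug (lamC k E) g d = GoodPlug E g d
GoodPlug (bangC E) g d = GoodPlug E g d
GoodPlug (valC E) g d = GoodPlug E g d
GoodPlug (cutV k E t) g d = ⊥
GoodPlug (cutB k v E) g d = GoodPlug E g d × ¬ DfvPlug E d here
GoodPlug (parB m k₁ k₂ E) g d = GoodPlug E g d
GoodPlug (subV m E k t) g d = GoodPlug E g d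
GoodPlug (subB m v k E) g d = GoodPlug E g d
GoodPlug (derB e k E) g d = GoodPlug E g d
DfvPlug hole d x = d x
DfvPlug (pairL E t) d x = DfvPlug E d x
DfvPlug (pairR t E) d x = DfvPlug E d x
DfvPlug (lamC k E) d x = DfvPlug E d (there x)
DfvPlug (bangC E) d x = DfvPlug E d x
DfvPlug (valC E) d x = DfvPlug E d x
DfvPlug (cutV k E t) d x = DfvPlug E d x
DfvPlug (cutB k v E) d x = DfvPlug E d (there x)
DfvPlug (parB m k₁ k₂ E) d x =
  DfvPlug E d (there (there x)) ⊎ (SameVar x m × (DfvPlug E d here ⊎ DfvPlug E d (there here)))
DfvPlug (subV m E k t) d x = SameVar x m ⊎ DfvPlug E d x
DfvPlug (subB m v k E) d x = DfvPlug E d (there x) ⊎ (SameVar x m × DfvPlug E d here)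
DfvPlug (derB e k E) d x = DfvPlug E d (there x) ⊎ (SameVar x e × DfvPlug E d here)


module _ {Δ Δ' : Scope} {R : VarRel Δ Δ'} {N : ℕ} where

  frame-pairL : ∀ {P : VarPred Δ'} {a b t' t g} {d : VarPred Δ} →
                Mirrors T R t' t → Explains T R P N a b g d →
                Explains V R P N (pair a t') (pair b t) g d
  frame-pairL sib e _ _ p-hole = created λ _ → tt , λ _ ()
  frame-pairL sib e (pairL Q _) w (p-pairL p) with e Q w p
  ... | traced o  = traced (origin-pairL o)
  ... | created k = created k
  ... | small n   = small n
  frame-pairL sib e (pairR _ Q) w (p-pairR p) = traced (origin-pairR (origin-none (sib Q w p)))

  frame-pairR : ∀ {P : VarPred Δ'} {a b t' t g} {d : VarPred Δ} →
                Mirrors T R t' t → Explains T R P N a b g d →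
                Explains V R P N (pair t' a) (pair t b) g d
  frame-pairR sib e _ _ p-hole = created λ _ → tt , λ _ ()
  frame-pairR sib e (pairR _ Q) w (p-pairR p) with e Q w p
  ... | traced o  = traced (origin-pairR o)
  ... | created k = created k
  ... | small n   = small n
  frame-pairR sib e (pairL Q _) w (p-pairL p) = traced (origin-pairL (origin-none (sib Q w p)))

  frame-lam : ∀ {k} {P : VarPred Δ'} {a b g} {d : VarPred (k ∷ Δ)} →
              Explains T (extRel R) (weakPred P) N a b g d →
              Explains V R P N (lam k a) (lam k b) g (λ x → d (there x))
  frame-lam e _ _ p-hole = created λ _ → tt , λ _ ()
  frame-lam e (lamC _ Q) w (p-lamC p) with e Q w p
  ... | traced o  = traced (origin-lam o)
  ... | created k = created λ g → let (gq , within) = k g in gq , λ x h → within (there x) h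
  ... | small n   = small n

  frame-bang : ∀ {P : VarPred Δ'} {a b g} {d : VarPred Δ} →
               Explains T R P N a b g d → Explains V R P N (bang a) (bang b) g d
  frame-bang e _ _ p-hole = created λ _ → tt , λ _ ()
  frame-bang e (bangC Q) w (p-bangC p) with e Q w p
  ... | traced o  = traced (origin-bang o)
  ... | created k = created k
  ... | small n   = small n

  frame-val : ∀ {P : VarPred Δ'} {a b g} {d : VarPred Δ} →
              Explains V R P N a b g d → Explains T R P N (val a) (val b) g d
  frame-val e (valC Q) w (p-valC p) with e Q w p
  ... | traced o  = traced (origin-val o)
  ... | created k = created k
  ... | small n   = small n

  frame-cutV : ∀ {k} {P : VarPred Δ'} {a b t' t g} {d : VarPred Δ} →
               Mirrors T (extRel R) t' t → Explains V R P N a b g d →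
               Explains T R P N (cut k a t') (cut k b t) ⊥ d
  frame-cutV sib e (cutV _ Q _) w (p-cutV p) with e Q w p
  ... | traced o  = traced (origin-cutV o)
  ... | created k = created λ ()
  ... | small n   = small n
  frame-cutV sib e (cutB _ _ Q) w (p-cutB p) = traced (origin-cutB (origin-none (sib Q w p)))

  frame-cutB : ∀ {k} {P : VarPred Δ'} {v' v a b g} {d : VarPred (k ∷ Δ)} →
               Mirrors V R v' v → Explains T (extRel R) (cutPred P) N a b g d →
               Explains T R P N (cut k v' a) (cut k v b) (g × ¬ d here) (λ x → d (there x))
  frame-cutB sib e (cutV _ Q _) w (p-cutV p) = traced (origin-cutV (origin-none (sib Q w p)))
  frame-cutB sib e (cutB _ _ Q) w (p-cutB p) with e Q w p
  ... | traced o  = traced (origin-cutB o)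
  ... | created k = created λ (g , notHere) →
          let (gq , within) = k g in
          (gq , λ h → notHere (within here h)) , λ x h → within (there x) h
  ... | small n   = small n

  frame-par : ∀ {k₁ k₂} {P : VarPred Δ'} {m : Δ ∋ 𝕞} {m' : Δ' ∋ 𝕞} {a b g} {d : VarPred (k₂ ∷ k₁ ∷ Δ)} →
              R m m' → Explains T (extRel (extRel R)) (weakPred (weakPred P)) N a b g d →
              Explains T R P N (par m' k₁ k₂ a) (par m k₁ k₂ b) g
                (λ x → d (there (there x)) ⊎ (SameVar x m × (d here ⊎ d (there here))))
  frame-par rm e (parB _ _ _ Q) w (p-parB p) with e Q w p
  ... | traced o  = traced (origin-par rm o)
  ... | created k = created λ g → let (gq , within) = k g in gq , λ
          { x (inj₁ h)             → inj₁ (within _ h)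
          ; x (inj₂ (sv , inj₁ h)) → inj₂ (sv , inj₁ (within _ h))
          ; x (inj₂ (sv , inj₂ h)) → inj₂ (sv , inj₂ (within _ h)) }
  ... | small n   = small n

  frame-subV : ∀ {k} {P : VarPred Δ'} {m : Δ ∋ 𝕞} {m' : Δ' ∋ 𝕞} {a b t' t g} {d : VarPred Δ} →
               R m m' → Explains V R P N a b g d → Mirrors T (extRel R) t' t →
               Explains T R P N (sub m' a k t') (sub m b k t) g (λ x → SameVar x m ⊎ d x)
  frame-subV rm e sib (subV _ Q _ _) w (p-subV p) with e Q w p
  ... | traced o  = traced (origin-subV rm o)
  ... | created k = created λ g → let (gq , within) = k g in gq , λ
          { x (inj₁ sv) → inj₁ sv
          ; x (inj₂ h)  → inj₂ (within x h) }
  ... | small n   = small n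
  frame-subV rm e sib (subB _ _ _ Q) w (p-subB p) =
    traced (origin-subB rm (origin-none (sib Q w p)))

  frame-subB : ∀ {k} {P : VarPred Δ'} {m : Δ ∋ 𝕞} {m' : Δ' ∋ 𝕞} {v' v a b g} {d : VarPred (k ∷ Δ)} →
               R m m' → Mirrors V R v' v → Explains T (extRel R) (weakPred P) N a b g d →
               Explains T R P N (sub m' v' k a) (sub m v k b) g
                 (λ x → d (there x) ⊎ (SameVar x m × d here))
  frame-subB rm sib e (subV _ Q _ _) w (p-subV p) =
    traced (origin-subV rm (origin-none (sib Q w p)))
  frame-subB rm sib e (subB _ _ _ Q) w (p-subB p) with e Q w p
  ... | traced o  = traced (origin-subB rm o)
  ... | created k = created λ g → let (gq , within) = k g in gq , λ
          { x (inj₁ h)        → inj₁ (within _ h)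
          ; x (inj₂ (sv , h)) → inj₂ (sv , within _ h) }
  ... | small n   = small n

  frame-der : ∀ {k} {P : VarPred Δ'} {e : Δ ∋ 𝕖} {e' : Δ' ∋ 𝕖} {a b g} {d : VarPred (k ∷ Δ)} →
              R e e' → Explains T (extRel R) (weakPred P) N a b g d →
              Explains T R P N (der e' k a) (der e k b) g
                (λ x → d (there x) ⊎ (SameVar x e × d here))
  frame-der re ex (derB _ _ Q) w (p-derB p) with ex Q w p
  ... | traced o  = traced (origin-der re o)
  ... | created k = created λ g → let (gq , within) = k g in gq , λ
          { x (inj₁ h)        → inj₁ (within _ h)
          ; x (inj₂ (sv , h)) → inj₂ (sv , within _ h) }
  ... | small n   = small n

frame : ∀ {Δ Δ'} {R : VarRel Δ Δ'} {s s'' Θ} {E' : Ctx s Δ' s'' Θ} {E : Ctx s Δ s'' Θ}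
        (c : Correspond R E' E) {P : VarPred Δ'} {N a b g} {d : VarPred (Θ ⋈ Δ)} →
        Explains s'' (holeRel c) (holePred c P) N a b g d →
        Explains s R P N (plug E' a) (plug E b) (GoodPlug E g d) (DfvPlug E d)
frame chole             e = e
frame (cpairL c sib)    e = frame-pairL sib (frame c e)
frame (cpairR sib c)    e = frame-pairR sib (frame c e)
frame (clamC c)         e = frame-lam (frame c e)
frame (cbangC c)        e = frame-bang (frame c e)
frame (cvalC c)         e = frame-val (frame c e)
frame (ccutV c sib)     e = frame-cutV sib (frame c e)
frame (ccutB sib c)     e = frame-cutB sib (frame c e)
frame (cparB rm c)      e = frame-par rm (frame c e)
frame (csubV rm c sib)  e = frame-subV rm (frame c e) sib
frame (csubB rm sib c)  e = frame-subB rm sib (frame c e)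
frame (cderB re c)      e = frame-der re (frame c e)

mirrors-ren : ∀ {s Γ Δ} (ρ : Ren Γ Δ) {R : VarRel Γ Δ} → (∀ {k} (x : Γ ∋ k) → R x (ρ x)) →
              (a : El s Γ) → Mirrors s R (ren ρ a) a
mirrors-ren ρ Rρ a {Θ} Q w p =
  origin (renC ρ Q) (renV (liftΘ Θ ρ) w) (plugged-ren ρ p) (≤-reflexive (sym (sizeV-renV (liftΘ Θ ρ) w)))
    (λ good _ → Good-renC⁻¹ ρ Q good , λ x h → ρ x , Rρ x , ∈dfv-renC ρ Q x h)

mirrors-refl : ∀ {s Γ} {R : VarRel Γ Γ} → (∀ {k} (x : Γ ∋ k) → R x x) → (a : El s Γ) → Mirrors s R a a
mirrors-refl Rr a Q w p = origin Q w p ≤-refl (λ good _ → good , λ x h → x , Rr x , h)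

extRel-graph : ∀ {Γ Δ k0} (ρ : Ren Γ Δ) {R : VarRel Γ Δ} → (∀ {k} (x : Γ ∋ k) → R x (ρ x)) →
               ∀ {k} (x : (k0 ∷ Γ) ∋ k) → extRel R x (ext ρ x)
extRel-graph ρ Rρ here      = tt
extRel-graph ρ Rρ (there x) = Rρ x

extRel-refl : ∀ {Γ k0} {R : VarRel Γ Γ} → (∀ {k} (x : Γ ∋ k) → R x x) →
              ∀ {k} (x : (k0 ∷ Γ) ∋ k) → extRel R x x
extRel-refl Rr here      = tt
extRel-refl Rr (there x) = Rr x

correspond-ren : ∀ {s Γ Δ s' Θ} (ρ : Ren Γ Δ) (R : VarRel Γ Δ) → (∀ {k} (x : Γ ∋ k) → R x (ρ x)) →
                 (E : Ctx s Γ s' Θ) → Correspond R (renC ρ E) E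
correspond-ren ρ R Rρ hole             = chole
correspond-ren ρ R Rρ (pairL E t)      = cpairL (correspond-ren ρ R Rρ E) (mirrors-ren ρ Rρ t)
correspond-ren ρ R Rρ (pairR t E)      = cpairR (mirrors-ren ρ Rρ t) (correspond-ren ρ R Rρ E)
correspond-ren ρ R Rρ (lamC k E)       =
  clamC (correspond-ren (ext ρ) (extRel R) (extRel-graph ρ Rρ) E)
correspond-ren ρ R Rρ (bangC E)        = cbangC (correspond-ren ρ R Rρ E)
correspond-ren ρ R Rρ (valC E)         = cvalC (correspond-ren ρ R Rρ E)
correspond-ren ρ R Rρ (cutV k E t)     =
  ccutV (correspond-ren ρ R Rρ E) (mirrors-ren (ext ρ) (extRel-graph ρ Rρ) t)
correspond-ren ρ R Rρ (cutB k v E)     =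
  ccutB (mirrors-ren ρ Rρ v) (correspond-ren (ext ρ) (extRel R) (extRel-graph ρ Rρ) E)
correspond-ren ρ R Rρ (parB m k₁ k₂ E) =
  cparB (Rρ m) (correspond-ren (ext (ext ρ)) (extRel (extRel R)) (extRel-graph (ext ρ) (extRel-graph ρ Rρ)) E)
correspond-ren ρ R Rρ (subV m E k t)   =
  csubV (Rρ m) (correspond-ren ρ R Rρ E) (mirrors-ren (ext ρ) (extRel-graph ρ Rρ) t)
correspond-ren ρ R Rρ (subB m v k E)   =
  csubB (Rρ m) (mirrors-ren ρ Rρ v) (correspond-ren (ext ρ) (extRel R) (extRel-graph ρ Rρ) E)
correspond-ren ρ R Rρ (derB e k E)     =
  cderB (Rρ e) (correspond-ren (ext ρ) (extRel R) (extRel-graph ρ Rρ) E)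

holeRel-ren : ∀ {s Γ Δ s' Θ} (ρ : Ren Γ Δ) (R : VarRel Γ Δ) (Rρ : ∀ {k} (x : Γ ∋ k) → R x (ρ x))
              (E : Ctx s Γ s' Θ) → ∀ {k} (x : (Θ ⋈ Γ) ∋ k) → holeRel (correspond-ren ρ R Rρ E) x (liftΘ Θ ρ x)
holeRel-ren ρ R Rρ hole             x = Rρ x
holeRel-ren ρ R Rρ (pairL E t)        = holeRel-ren ρ R Rρ E
holeRel-ren ρ R Rρ (pairR t E)        = holeRel-ren ρ R Rρ E
holeRel-ren ρ R Rρ (lamC k E)         = holeRel-ren (ext ρ) (extRel R) (extRel-graph ρ Rρ) E
holeRel-ren ρ R Rρ (bangC E)          = holeRel-ren ρ R Rρ E
holeRel-ren ρ R Rρ (valC E)           = holeRel-ren ρ R Rρ E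
holeRel-ren ρ R Rρ (cutV k E t)       = holeRel-ren ρ R Rρ E
holeRel-ren ρ R Rρ (cutB k v E)       = holeRel-ren (ext ρ) (extRel R) (extRel-graph ρ Rρ) E
holeRel-ren ρ R Rρ (parB m k₁ k₂ E)   =
  holeRel-ren (ext (ext ρ)) (extRel (extRel R)) (extRel-graph (ext ρ) (extRel-graph ρ Rρ)) E
holeRel-ren ρ R Rρ (subV m E k t)     = holeRel-ren ρ R Rρ E
holeRel-ren ρ R Rρ (subB m v k E)     = holeRel-ren (ext ρ) (extRel R) (extRel-graph ρ Rρ) E
holeRel-ren ρ R Rρ (derB e k E)       = holeRel-ren (ext ρ) (extRel R) (extRel-graph ρ Rρ) E

correspond-refl : ∀ {s Γ s' Θ} (R : VarRel Γ Γ) → (∀ {k} (x : Γ ∋ k) → R x x) →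
                  (E : Ctx s Γ s' Θ) → Correspond R E E
correspond-refl R Rr hole             = chole
correspond-refl R Rr (pairL E t)      = cpairL (correspond-refl R Rr E) (mirrors-refl Rr t)
correspond-refl R Rr (pairR t E)      = cpairR (mirrors-refl Rr t) (correspond-refl R Rr E)
correspond-refl R Rr (lamC k E)       = clamC (correspond-refl (extRel R) (extRel-refl Rr) E)
correspond-refl R Rr (bangC E)        = cbangC (correspond-refl R Rr E)
correspond-refl R Rr (valC E)         = cvalC (correspond-refl R Rr E)
correspond-refl R Rr (cutV k E t)     = ccutV (correspond-refl R Rr E) (mirrors-refl (extRel-refl Rr) t)
correspond-refl R Rr (cutB k v E)     = ccutB (mirrors-refl Rr v) (correspond-refl (extRel R) (extRel-refl Rr) E)
correspond-refl R Rr (parB m k₁ k₂ E) =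
  cparB (Rr m) (correspond-refl (extRel (extRel R)) (extRel-refl (extRel-refl Rr)) E)
correspond-refl R Rr (subV m E k t)   =
  csubV (Rr m) (correspond-refl R Rr E) (mirrors-refl (extRel-refl Rr) t)
correspond-refl R Rr (subB m v k E)   =
  csubB (Rr m) (mirrors-refl Rr v) (correspond-refl (extRel R) (extRel-refl Rr) E)
correspond-refl R Rr (derB e k E)     = cderB (Rr e) (correspond-refl (extRel R) (extRel-refl Rr) E)

holeRel-refl : ∀ {s Γ s' Θ} (R : VarRel Γ Γ) (Rr : ∀ {k} (x : Γ ∋ k) → R x x) (E : Ctx s Γ s' Θ) →
               ∀ {k} (x : (Θ ⋈ Γ) ∋ k) → holeRel (correspond-refl R Rr E) x x
holeRel-refl R Rr hole             x = Rr x
holeRel-refl R Rr (pairL E t)        = holeRel-refl R Rr E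
holeRel-refl R Rr (pairR t E)        = holeRel-refl R Rr E
holeRel-refl R Rr (lamC k E)         = holeRel-refl (extRel R) (extRel-refl Rr) E
holeRel-refl R Rr (bangC E)          = holeRel-refl R Rr E
holeRel-refl R Rr (valC E)           = holeRel-refl R Rr E
holeRel-refl R Rr (cutV k E t)       = holeRel-refl R Rr E
holeRel-refl R Rr (cutB k v E)       = holeRel-refl (extRel R) (extRel-refl Rr) E
holeRel-refl R Rr (parB m k₁ k₂ E)   = holeRel-refl (extRel (extRel R)) (extRel-refl (extRel-refl Rr)) E
holeRel-refl R Rr (subV m E k t)     = holeRel-refl R Rr E
holeRel-refl R Rr (subB m v k E)     = holeRel-refl (extRel R) (extRel-refl Rr) E
holeRel-refl R Rr (derB e k E)       = holeRel-refl (extRel R) (extRel-refl Rr) E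

holePred-wk : ∀ {Δ Δ'} {R : VarRel Δ Δ'} {s s' Θ} {E' : Ctx s Δ' s' Θ} {E : Ctx s Δ s' Θ}
              (c : Correspond R E' E) (P : VarPred Δ') → ∀ {k} (y : Δ' ∋ k) → P y → holePred c P (wkΘ Θ y)
holePred-wk chole         P y p = p
holePred-wk (cpairL c _)  P y p = holePred-wk c P y p
holePred-wk (cpairR _ c)  P y p = holePred-wk c P y p
holePred-wk (clamC c)     P y p = holePred-wk c (weakPred P) (there y) p
holePred-wk (cbangC c)    P y p = holePred-wk c P y p
holePred-wk (cvalC c)     P y p = holePred-wk c P y p
holePred-wk (ccutV c _)   P y p = holePred-wk c P y p
holePred-wk (ccutB _ c)   P y p = holePred-wk c (cutPred P) (there y) p
holePred-wk (cparB _ c)   P y p = holePred-wk c (weakPred (weakPred P)) (there (there y)) p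
holePred-wk (csubV _ c _) P y p = holePred-wk c P y p
holePred-wk (csubB _ _ c) P y p = holePred-wk c (weakPred P) (there y) p
holePred-wk (cderB _ c)   P y p = holePred-wk c (weakPred P) (there y) p

DfvPlug-compose : ∀ {s₁ Γ s₂ Θ₁ s₃ Θ₂} (C : Ctx s₁ Γ s₂ Θ₁) (X : Ctx s₂ (Θ₁ ⋈ Γ) s₃ Θ₂) →
                  ∀ {k} (x : Γ ∋ k) → DfvPlug C (_∈dfv X) x → x ∈dfv compose C X
DfvPlug-compose hole             X x h = h
DfvPlug-compose (pairL C t)      X x h = DfvPlug-compose C X x h
DfvPlug-compose (pairR t C)      X x h = DfvPlug-compose C X x h
DfvPlug-compose (lamC k C)       X x h = DfvPlug-compose C X (there x) h
DfvPlug-compose (bangC C)        X x h = DfvPlug-compose C X x h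
DfvPlug-compose (valC C)         X x h = DfvPlug-compose C X x h
DfvPlug-compose (cutV k C t)     X x h = DfvPlug-compose C X x h
DfvPlug-compose (cutB k v C)     X x h = DfvPlug-compose C X (there x) h
DfvPlug-compose (parB m k₁ k₂ C) X x (inj₁ h)             = inj₁ (DfvPlug-compose C X _ h)
DfvPlug-compose (parB m k₁ k₂ C) X x (inj₂ (sv , inj₁ h)) = inj₂ (sv , inj₁ (DfvPlug-compose C X _ h))
DfvPlug-compose (parB m k₁ k₂ C) X x (inj₂ (sv , inj₂ h)) = inj₂ (sv , inj₂ (DfvPlug-compose C X _ h))
DfvPlug-compose (subV m C k t)   X x (inj₁ sv)            = inj₁ sv
DfvPlug-compose (subV m C k t)   X x (inj₂ h)             = inj₂ (DfvPlug-compose C X x h)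
DfvPlug-compose (subB m v k C)   X x (inj₁ h)             = inj₁ (DfvPlug-compose C X _ h)
DfvPlug-compose (subB m v k C)   X x (inj₂ (sv , h))      = inj₂ (sv , DfvPlug-compose C X _ h)
DfvPlug-compose (derB e k C)     X x (inj₁ h)             = inj₁ (DfvPlug-compose C X _ h)
DfvPlug-compose (derB e k C)     X x (inj₂ (sv , h))      = inj₂ (sv , DfvPlug-compose C X _ h)

GoodPlug-compose : ∀ {s₁ Γ s₂ Θ₁ s₃ Θ₂} (C : Ctx s₁ Γ s₂ Θ₁) (X : Ctx s₂ (Θ₁ ⋈ Γ) s₃ Θ₂) →
                   Good (compose C X) → GoodPlug C (Good X) (_∈dfv X)
GoodPlug-compose hole             X g       = g
GoodPlug-compose (pairL C t)      X g       = GoodPlug-compose C X g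
GoodPlug-compose (pairR t C)      X g       = GoodPlug-compose C X g
GoodPlug-compose (lamC k C)       X g       = GoodPlug-compose C X g
GoodPlug-compose (bangC C)        X g       = GoodPlug-compose C X g
GoodPlug-compose (valC C)         X g       = GoodPlug-compose C X g
GoodPlug-compose (cutB k v C)     X (g , n) = GoodPlug-compose C X g , λ h → n (DfvPlug-compose C X here h)
GoodPlug-compose (parB m k₁ k₂ C) X g       = GoodPlug-compose C X g
GoodPlug-compose (subV m C k t)   X g       = GoodPlug-compose C X g
GoodPlug-compose (subB m v k C)   X g       = GoodPlug-compose C X g
GoodPlug-compose (derB e k C)     X g       = GoodPlug-compose C X g

DfvPlug-none : ∀ {s Γ s' Θ} (C : Ctx s Γ s' Θ) → ∀ {k} (x : Γ ∋ k) → DfvPlug C none x → x ∈dfv C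
DfvPlug-none (pairL C t)      x h = DfvPlug-none C x h
DfvPlug-none (pairR t C)      x h = DfvPlug-none C x h
DfvPlug-none (lamC k C)       x h = DfvPlug-none C (there x) h
DfvPlug-none (bangC C)        x h = DfvPlug-none C x h
DfvPlug-none (valC C)         x h = DfvPlug-none C x h
DfvPlug-none (cutV k C t)     x h = DfvPlug-none C x h
DfvPlug-none (cutB k v C)     x h = DfvPlug-none C (there x) h
DfvPlug-none (parB m k₁ k₂ C) x (inj₁ h)             = inj₁ (DfvPlug-none C _ h)
DfvPlug-none (parB m k₁ k₂ C) x (inj₂ (sv , inj₁ h)) = inj₂ (sv , inj₁ (DfvPlug-none C _ h))
DfvPlug-none (parB m k₁ k₂ C) x (inj₂ (sv , inj₂ h)) = inj₂ (sv , inj₂ (DfvPlug-none C _ h))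
DfvPlug-none (subV m C k t)   x (inj₁ sv)            = inj₁ sv
DfvPlug-none (subV m C k t)   x (inj₂ h)             = inj₂ (DfvPlug-none C x h)
DfvPlug-none (subB m v k C)   x (inj₁ h)             = inj₁ (DfvPlug-none C _ h)
DfvPlug-none (subB m v k C)   x (inj₂ (sv , h))      = inj₂ (sv , DfvPlug-none C _ h)
DfvPlug-none (derB e k C)     x (inj₁ h)             = inj₁ (DfvPlug-none C _ h)
DfvPlug-none (derB e k C)     x (inj₂ (sv , h))      = inj₂ (sv , DfvPlug-none C _ h)

GoodPlug-none : ∀ {s Γ s' Θ} (C : Ctx s Γ s' Θ) → Good C → GoodPlug C ⊤ none
GoodPlug-none hole             g       = tt
GoodPlug-none (pairL C t)      g       = GoodPlug-none C g
GoodPlug-none (pairR t C)      g       = GoodPlug-none C g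
GoodPlug-none (lamC k C)       g       = GoodPlug-none C g
GoodPlug-none (bangC C)        g       = GoodPlug-none C g
GoodPlug-none (valC C)         g       = GoodPlug-none C g
GoodPlug-none (cutB k v C)     (g , n) = GoodPlug-none C g , λ h → n (DfvPlug-none C here h)
GoodPlug-none (parB m k₁ k₂ C) g       = GoodPlug-none C g
GoodPlug-none (subV m C k t)   g       = GoodPlug-none C g
GoodPlug-none (subB m v k C)   g       = GoodPlug-none C g
GoodPlug-none (derB e k C)     g       = GoodPlug-none C g

explains-drop-cut : ∀ {Δ Δ' k} {R : VarRel Δ Δ'} {P : VarPred Δ'} {N} {v : Val Δ'}
                    {a : Tm (k ∷ Δ')} {b : Tm Δ} {g} {d : VarPred Δ} →
                    Explains T (weakRelʳ R) (cutPred P) N a b g d → Explains T R P N (cut k v a) b g d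
explains-drop-cut {k = k} {R = R} {v = v} e Q w p with e Q w p
... | created c = created c
... | small n   = small n
... | traced (origin Q' w' pl sz ok) =
  traced (origin (cutB k v Q') w' (p-cutB pl) sz λ (gq' , nh) np →
    let (gq , cov) = ok gq' (λ { here _ → nh ; (there y) py d → np y py d }) in
    gq , λ x h → unshift (cov x h))
  where
  unshift : ∀ {kk} {x : _ ∋ kk} → Σ (_ ∋ kk) (λ y → weakRelʳ R x y × y ∈dfv Q') →
            Σ (_ ∋ kk) λ y → R x y × y ∈dfv cutB k v Q'
  unshift (there y , r , d) = y , r , d

-- The variable of a binder introduced by the step is related to nothing (weakRelˡ), hence
-- never dominates a traced occurrence.
module _ {Δ Δ' : Scope} {R : VarRel Δ Δ'} {P : VarPred Δ'} {N : ℕ} {a : Tm Δ'} where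

  explains-intro-cut : ∀ {k} {v : Val Δ} {X : Tm (k ∷ Δ)} →
                       (∀ {Θ} (Q : Ctx V Δ V Θ) w → Plugged Q w v →
                          Explained R P N a ⊤ none (cutV k Q X) w) →
                       Explains T (weakRelˡ R) P N a X ⊤ none →
                       Explains T R P N a (cut k v X) ⊤ none
  explains-intro-cut inValue e _ _ (p-cutV p) = inValue _ _ p
  explains-intro-cut inValue e (cutB _ _ Q) w (p-cutB p) with e Q w p
  ... | traced (origin Q' w' pl sz ok) = traced (origin Q' w' pl sz λ g np →
          let (gq , cov) = ok g np in
          (gq , λ h → proj₁ (proj₂ (cov here h))) , λ x h → cov (there x) h)
  ... | created c = created λ _ → let (gq , within) = c tt in
          (gq , λ h → within here h) , λ x h → within (there x) h
  ... | small n   = small n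

  explains-intro-cut-small : ∀ {k} {v : Val Δ} {X : Tm (k ∷ Δ)} → sizeV v ≤ N →
                             Explains T (weakRelˡ R) P N a X ⊤ none →
                             Explains T R P N a (cut k v X) ⊤ none
  explains-intro-cut-small v≤N =
    explains-intro-cut (λ Q w p → small (≤-trans (plugged-size≤ p) v≤N))

  explains-intro-par : ∀ {k₁ k₂} {m : Δ ∋ 𝕞} {X : Tm (k₂ ∷ k₁ ∷ Δ)} →
                       Explains T (weakRelˡ (weakRelˡ R)) P N a X ⊤ none →
                       Explains T R P N a (par m k₁ k₂ X) ⊤ none
  explains-intro-par e (parB _ _ _ Q) w (p-parB p) with e Q w p
  ... | traced (origin Q' w' pl sz ok) = traced (origin Q' w' pl sz λ g np →
          let (gq , cov) = ok g np in gq , λ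
            { x (inj₁ h)             → cov _ h
            ; x (inj₂ (sv , inj₁ h)) → ⊥-elim (proj₁ (proj₂ (cov here h)))
            ; x (inj₂ (sv , inj₂ h)) → ⊥-elim (proj₁ (proj₂ (cov (there here) h))) })
  ... | created c = created λ _ → let (gq , within) = c tt in gq , λ
            { x (inj₁ h)             → within _ h
            ; x (inj₂ (sv , inj₁ h)) → within _ h
            ; x (inj₂ (sv , inj₂ h)) → within _ h }
  ... | small n   = small n

  explains-intro-sub-small : ∀ {k} {m : Δ ∋ 𝕞} {v : Val Δ} {X : Tm (k ∷ Δ)} →
                             sizeV v ≤ N →
                             Explains T (weakRelˡ R) P N a X ⊤ none →
                             Explains T R P N a (sub m v k X) ⊤ none
  explains-intro-sub-small v≤N e _ _ (p-subV p) = small (≤-trans (plugged-size≤ p) v≤N)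
  explains-intro-sub-small v≤N e (subB _ _ _ Q) w (p-subB p) with e Q w p
  ... | traced (origin Q' w' pl sz ok) = traced (origin Q' w' pl sz λ g np →
          let (gq , cov) = ok g np in gq , λ
            { x (inj₁ h)        → cov _ h
            ; x (inj₂ (sv , h)) → ⊥-elim (proj₁ (proj₂ (cov here h))) })
  ... | created c = created λ _ → let (gq , within) = c tt in gq , λ
            { x (inj₁ h)        → within _ h
            ; x (inj₂ (sv , h)) → within _ h }
  ... | small n   = small n

  explains-intro-der : ∀ {k} {e : Δ ∋ 𝕖} {X : Tm (k ∷ Δ)} →
                       Explains T (weakRelˡ R) P N a X ⊤ none →
                       Explains T R P N a (der e k X) ⊤ none
  explains-intro-der ex (derB _ _ Q) w (p-derB p) with ex Q w p
  ... | traced (origin Q' w' pl sz ok) = traced (origin Q' w' pl sz λ g np →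
          let (gq , cov) = ok g np in gq , λ
            { x (inj₁ h)        → cov _ h
            ; x (inj₂ (sv , h)) → ⊥-elim (proj₁ (proj₂ (cov here h))) })
  ... | created c = created λ _ → let (gq , within) = c tt in gq , λ
            { x (inj₁ h)        → within _ h
            ; x (inj₂ (sv , h)) → within _ h }
  ... | small n   = small n

-- leftRel and SmallLeft are only meant for left contexts (IsL); other cases are junk.
leftRel : ∀ {Δ Δ' Φ} → Ctx T Δ T Φ → VarRel Δ Δ' → VarRel (Φ ⋈ Δ) Δ'
leftRel hole             R = R
leftRel (valC L)         R = λ _ _ → ⊥
leftRel (cutV k L t)     R = λ _ _ → ⊥
leftRel (cutB k v L)     R = leftRel L (weakRelˡ R)
leftRel (parB m k₁ k₂ L) R = leftRel L (weakRelˡ (weakRelˡ R))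
leftRel (subV m L k t)   R = λ _ _ → ⊥
leftRel (subB m v k L)   R = leftRel L (weakRelˡ R)
leftRel (derB e k L)     R = leftRel L (weakRelˡ R)

leftRel-wk : ∀ {Δ Δ' Φ} (L : Ctx T Δ T Φ) {R : VarRel Δ Δ'} → IsL L →
             ∀ {k} (x : Δ ∋ k) y → R x y → leftRel L R (wkΘ Φ x) y
leftRel-wk hole             il x y r = r
leftRel-wk (cutB k v L)     il x y r = leftRel-wk L il (there x) y r
leftRel-wk (parB m k₁ k₂ L) il x y r = leftRel-wk L il (there (there x)) y r
leftRel-wk (subB m v k L)   il x y r = leftRel-wk L il (there x) y r
leftRel-wk (derB e k L)     il x y r = leftRel-wk L il (there x) y r

SmallLeft : ∀ {Δ Φ} → Ctx T Δ T Φ → ℕ → Set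
SmallLeft hole             N = ⊤
SmallLeft (valC L)         N = ⊤
SmallLeft (cutV k L t)     N = ⊤
SmallLeft (cutB k v L)     N = sizeV v ≤ N × SmallLeft L N
SmallLeft (parB m k₁ k₂ L) N = SmallLeft L N
SmallLeft (subV m L k t)   N = ⊤
SmallLeft (subB m v k L)   N = sizeV v ≤ N × SmallLeft L N
SmallLeft (derB e k L)     N = SmallLeft L N

explains-intro-left : ∀ {Δ Δ' Φ} {R : VarRel Δ Δ'} {P : VarPred Δ'} {N} {a : Tm Δ'}
                      (L : Ctx T Δ T Φ) → IsL L → SmallLeft L N →
                      ∀ {X} → Explains T (leftRel L R) P N a X ⊤ none → Explains T R P N a (plug L X) ⊤ none
explains-intro-left hole             il sz        e = e
explains-intro-left (cutB k v L)     il (v≤ , sz) e = explains-intro-cut-small v≤ (explains-intro-left L il sz e)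
explains-intro-left (parB m k₁ k₂ L) il sz        e = explains-intro-par (explains-intro-left L il sz e)
explains-intro-left (subB m v k L)   il (v≤ , sz) e = explains-intro-sub-small v≤ (explains-intro-left L il sz e)
explains-intro-left (derB f k L)     il sz        e = explains-intro-der (explains-intro-left L il sz e)

IsL-renC : ∀ {Δ Δ₂ Φ} (ρ : Ren Δ Δ₂) (L : Ctx T Δ T Φ) → IsL L → IsL (renC ρ L)
IsL-renC ρ hole             il = tt
IsL-renC ρ (cutB k v L)     il = IsL-renC (ext ρ) L il
IsL-renC ρ (parB m k₁ k₂ L) il = IsL-renC (ext (ext ρ)) L il
IsL-renC ρ (subB m v k L)   il = IsL-renC (ext ρ) L il
IsL-renC ρ (derB e k L)     il = IsL-renC (ext ρ) L il

SmallLeft-renC : ∀ {Δ Δ₂ Φ} (ρ : Ren Δ Δ₂) (L : Ctx T Δ T Φ) {N} → IsL L →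
                 SmallLeft L N → SmallLeft (renC ρ L) N
SmallLeft-renC ρ hole             il sz        = tt
SmallLeft-renC ρ (cutB k v L)     il (v≤ , sz) =
  subst (_≤ _) (sym (sizeV-renV ρ v)) v≤ , SmallLeft-renC (ext ρ) L il sz
SmallLeft-renC ρ (parB m k₁ k₂ L) il sz        = SmallLeft-renC (ext (ext ρ)) L il sz
SmallLeft-renC ρ (subB m v k L)   il (v≤ , sz) =
  subst (_≤ _) (sym (sizeV-renV ρ v)) v≤ , SmallLeft-renC (ext ρ) L il sz
SmallLeft-renC ρ (derB e k L)     il sz        = SmallLeft-renC (ext ρ) L il sz

SmallLeft-plug : ∀ {Δ Φ} (L : Ctx T Δ T Φ) {N} → IsL L → ∀ u → sizeT (plug L u) ≤ N →
                 SmallLeft L N × sizeT u ≤ N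
SmallLeft-plug hole             il u h = tt , h
SmallLeft-plug (cutB k v L)     il u h =
  let (sz , u≤) = SmallLeft-plug L il u (m+n≤o⇒n≤o (sizeV v) (<⇒≤ h)) in
  (m+n≤o⇒m≤o (sizeV v) (<⇒≤ h) , sz) , u≤
SmallLeft-plug (parB m k₁ k₂ L) il u h = SmallLeft-plug L il u (<⇒≤ h)
SmallLeft-plug (subB m v k L)   il u h =
  let (sz , u≤) = SmallLeft-plug L il u (m+n≤o⇒n≤o (sizeV v) (<⇒≤ h)) in
  (m+n≤o⇒m≤o (sizeV v) (<⇒≤ h) , sz) , u≤
SmallLeft-plug (derB e k L)     il u h = SmallLeft-plug L il u (<⇒≤ h)

explains-intro-Lcut : ∀ {Δ₀ Δ Δ' Φ k} {R : VarRel Δ Δ'} {P : VarPred Δ'} {N} {a : Tm Δ'}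
                      (L : Ctx T Δ₀ T Φ) → IsL L → (v : Val (Φ ⋈ Δ₀)) → sizeT (plug L (val v)) ≤ N →
                      (ρ : Ren Δ₀ Δ) {X : Tm (k ∷ (Φ ⋈ Δ))} →
                      Explains T (weakRelˡ (leftRel (renC ρ L) R)) P N a X ⊤ none →
                      Explains T R P N a (plug (renC ρ L) (cut k (renV (liftΘ Φ ρ) v) X)) ⊤ none
explains-intro-Lcut L il v h ρ e =
  let (smallL , v≤) = SmallLeft-plug L il (val v) h in
  explains-intro-left (renC ρ L) (IsL-renC ρ L il) (SmallLeft-renC ρ L il smallL)
    (explains-intro-cut-small (subst (_≤ _) (sym (sizeV-renV _ v)) v≤) e)

explains-der-body : ∀ {Δ Δ₂ kx} (σ : Ren Δ Δ₂) (R : VarRel (kx ∷ Δ₂) Δ) →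
                    (∀ {k} (x : Δ ∋ k) → R (there (σ x)) x) →
                    (P : VarPred Δ) (e : Δ ∋ 𝕖) → P e → (t : Tm (kx ∷ Δ)) →
                    ∀ {N g} {d : VarPred (kx ∷ Δ₂)} →
                    Explains T R P N (der e kx t) (renT (ext σ) t) g d
explains-der-body {kx = kx} σ R Rσ P e Pe t Q w p with plugged-renT⁻¹ (ext σ) t p
... | renamedOcc Q₀ w₀ p₀ refl refl =
  traced (origin (derB e kx Q₀) w₀ (p-derB p₀) (≤-reflexive (sizeV-renV _ w₀)) λ good np →
    Good-renC (ext σ) Q₀ good , covered (λ h → np e Pe (inj₂ (SameVar-refl e , h))))
  where
  covered : ¬ (here ∈dfv Q₀) → DfvCovered R (renC (ext σ) Q₀) (derB e kx Q₀)
  covered notHere x h with ∈dfv-renC⁻¹ (ext σ) Q₀ x h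
  ... | here    , d , _    = ⊥-elim (notHere d)
  ... | there z , d , refl = z , Rσ z , inj₁ d

explains-par-body : ∀ {Δ Δa Δ₂ k₁ k₂} (τ : Ren Δ Δa) (σ : Ren (k₁ ∷ Δ) Δ₂)
                    (R : VarRel (k₂ ∷ Δ₂) Δa) → (∀ {k} (x : Δ ∋ k) → R (there (σ (there x))) (τ x)) →
                    (P : VarPred Δa) (m : Δa ∋ 𝕞) → P m → (t : Tm (k₂ ∷ k₁ ∷ Δ)) →
                    ∀ {N g} {d : VarPred (k₂ ∷ Δ₂)} →
                    Explains T R P N (par m k₁ k₂ (renT (ext (ext τ)) t)) (renT (ext σ) t) g d
explains-par-body {Δa = Δa} {k₁ = k₁} {k₂} τ σ R Rσ P m Pm t {Θ = Θ} Q w p with plugged-renT⁻¹ (ext σ) t p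
... | renamedOcc Q₀ w₀ p₀ refl refl =
  traced (origin (parB m k₁ k₂ Q₁) (renV (liftΘ Θ (ext (ext τ))) w₀) (p-parB (plugged-ren (ext (ext τ)) p₀))
                 (≤-reflexive (trans (sizeV-renV _ w₀) (sym (sizeV-renV _ w₀)))) λ good np →
    Good-renC (ext σ) Q₀ (Good-renC⁻¹ (ext (ext τ)) Q₀ good) ,
    covered (λ h → np m Pm (inj₂ (SameVar-refl m , inj₁ (∈dfv-renC (ext (ext τ)) Q₀ here h))))
            (λ h → np m Pm (inj₂ (SameVar-refl m , inj₂ (∈dfv-renC (ext (ext τ)) Q₀ (there here) h)))))
  where
  Q₁ : Ctx T (k₂ ∷ k₁ ∷ Δa) V Θ
  Q₁ = renC (ext (ext τ)) Q₀
  covered : ¬ (here ∈dfv Q₀) → ¬ (there here ∈dfv Q₀) → DfvCovered R (renC (ext σ) Q₀) (parB m k₁ k₂ Q₁)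
  covered notHere notThere x h with ∈dfv-renC⁻¹ (ext σ) Q₀ x h
  ... | here            , d , _    = ⊥-elim (notHere d)
  ... | there here      , d , _    = ⊥-elim (notThere d)
  ... | there (there z) , d , refl =
    τ z , Rσ z , inj₁ (∈dfv-renC (ext (ext τ)) Q₀ (there (there z)) d)

explains-sub-body : ∀ {Δ Δa Δ₂ kx} (τ : Ren Δ Δa) (σ : Ren Δ Δ₂) (R : VarRel (kx ∷ Δ₂) Δa) →
                    (∀ {k} (x : Δ ∋ k) → R (there (σ x)) (τ x)) →
                    (P : VarPred Δa) (m : Δa ∋ 𝕞) → P m → (u : Val Δa) (t : Tm (kx ∷ Δ)) →
                    ∀ {N g} {d : VarPred (kx ∷ Δ₂)} →
                    Explains T R P N (sub m u kx (renT (ext τ) t)) (renT (ext σ) t) g d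
explains-sub-body {Δa = Δa} {kx = kx} τ σ R Rσ P m Pm u t {Θ = Θ} Q w p with plugged-renT⁻¹ (ext σ) t p
... | renamedOcc Q₀ w₀ p₀ refl refl =
  traced (origin (subB m u kx Q₁) (renV (liftΘ Θ (ext τ)) w₀) (p-subB (plugged-ren (ext τ) p₀))
                 (≤-reflexive (trans (sizeV-renV _ w₀) (sym (sizeV-renV _ w₀)))) λ good np →
    Good-renC (ext σ) Q₀ (Good-renC⁻¹ (ext τ) Q₀ good) ,
    covered (λ h → np m Pm (inj₂ (SameVar-refl m , ∈dfv-renC (ext τ) Q₀ here h))))
  where
  Q₁ : Ctx T (kx ∷ Δa) V Θ
  Q₁ = renC (ext τ) Q₀
  covered : ¬ (here ∈dfv Q₀) → DfvCovered R (renC (ext σ) Q₀) (subB m u kx Q₁)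
  covered notHere x h with ∈dfv-renC⁻¹ (ext σ) Q₀ x h
  ... | here    , d , _    = ⊥-elim (notHere d)
  ... | there z , d , refl = τ z , Rσ z , inj₁ (∈dfv-renC (ext τ) Q₀ (there z) d)

explains-der-swap : ∀ {Δ} (R : VarRel Δ Δ) → (∀ {k} (x : Δ ∋ k) → R x x) →
                    (P : VarPred Δ) (e f : Δ ∋ 𝕖) → P e → ∀ kx (t : Tm (kx ∷ Δ)) →
                    ∀ {N g} {d : VarPred Δ} → Explains T R P N (der e kx t) (der f kx t) g d
explains-der-swap R Rr P e f Pe kx t (derB _ _ Q) w (p-derB p) =
  traced (origin (derB e kx Q) w (p-derB p) ≤-refl λ good np → good , λ
    { x (inj₁ h)        → x , Rr x , inj₁ h
    ; x (inj₂ (sv , h)) → ⊥-elim (np e Pe (inj₂ (SameVar-refl e , h))) })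

Same : ∀ {Δ} → VarRel Δ Δ
Same x y = x ≡ y

correspond-self : ∀ {s Γ s' Θ} (E : Ctx s Γ s' Θ) → Correspond Same E E
correspond-self = correspond-refl Same (λ _ → refl)

holeRel-self : ∀ {s Γ s' Θ} (E : Ctx s Γ s' Θ) →
               ∀ {k} (x : (Θ ⋈ Γ) ∋ k) y → Same x y → holeRel (correspond-self E) x y
holeRel-self E x _ refl = holeRel-refl Same (λ _ → refl) E x

correspond-shift : ∀ {s Γ s' Θ k} (E : Ctx s Γ s' Θ) →
                   Correspond (weakRelʳ Same) (renC (there {k' = k}) E) E
correspond-shift = correspond-ren there (weakRelʳ Same) (λ _ → refl)

holeRel-shift : ∀ {s Γ s' Θ k} (E : Ctx s Γ s' Θ) →
                ∀ {k'} (x : (Θ ⋈ Γ) ∋ k') → holeRel (correspond-shift {k = k} E) x (liftΘ Θ there x)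
holeRel-shift = holeRel-ren there (weakRelʳ Same) (λ _ → refl)

holePred-self-cut : ∀ {Γ s Θ k} (v : Val Γ) (E : Ctx T (k ∷ Γ) s Θ) →
                    holePred (correspond-self (cutB k v E)) none (wkΘ Θ here)
holePred-self-cut v E =
  holePred-wk (correspond-refl (extRel Same) (extRel-refl (λ _ → refl)) E) (cutPred none) here tt

ExplainsRoot : ∀ {Γ k s Θ} → Val Γ → Tm (k ∷ Γ) → Tm Γ → Ctx T (k ∷ Γ) s Θ → Set
ExplainsRoot {k = k} v body r D =
  Explains T Same none (sizeV v) (cut k v body) r (Good (cutB k v D)) (_∈dfv cutB k v D)

-- Multiplicative rules consume the fired cut, exponential rules keep it.
explains-root-mult : ∀ {Γ Θ s k} (M : Ctx T Γ s Θ) {v : Val Γ} {a b} →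
                     Explains s (holeRel (correspond-shift {k = k} M))
                       (holePred (correspond-shift M) (cutPred none)) (sizeV v) a b ⊤ none →
                     ExplainsRoot v (plug (renC there M) a) (plug M b) (renC there M)
explains-root-mult M e =
  explains-mono (λ _ _ r → r) (λ _ p → p) ≤-refl
    (λ (good , _) → GoodPlug-none M (Good-renC⁻¹ there M good))
    (λ x h → ∈dfv-renC there M x (DfvPlug-none M x h))
    (explains-drop-cut (frame (correspond-shift M) e))

explains-root-exp : ∀ {Γ Θ s} (v : Val Γ) (C : Ctx T (𝕖 ∷ Γ) s Θ) {a b} →
                    Explains s (holeRel (correspond-self (cutB 𝕖 v C)))
                      (holePred (correspond-self (cutB 𝕖 v C)) none) (sizeV v) a b ⊤ none →
                    ExplainsRoot v (plug C a) (cut 𝕖 v (plug C b)) C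
explains-root-exp v C e =
  explains-mono (λ _ _ r → r) (λ _ p → p) ≤-refl (GoodPlug-none (cutB 𝕖 v C))
    (DfvPlug-none (cutB 𝕖 v C)) (frame (correspond-self (cutB 𝕖 v C)) e)

explains-ax-m1 : ∀ {Γ Θ} (v : Val Γ) (M : Ctx T Γ V Θ) →
                 ExplainsRoot v (plug (renC there M) (mvar (wkΘ Θ here))) (plug M (renV (wkΘ Θ) v))
                   (renC there M)
explains-ax-m1 {Θ = Θ} v M =
  explains-root-mult M (explains-small (renV (wkΘ Θ) v) (≤-reflexive (sizeV-renV _ v)))

explains-ax-m2 : ∀ {Γ} (n : Γ ∋ 𝕞) (body : Tm (𝕞 ∷ Γ)) {N g} {d : VarPred Γ} →
                 Explains T Same none N (cut 𝕞 (mvar n) body) (renT (ren1 n) body) g d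
explains-ax-m2 n body Q w p with plugged-renT⁻¹ (ren1 n) body p
... | renamedOcc Q₀ w₀ p₀ refl refl =
  traced (origin (cutB 𝕞 (mvar n) Q₀) w₀ (p-cutB p₀) (≤-reflexive (sizeV-renV _ w₀))
    λ (good , notHere) _ → Good-renC (ren1 n) Q₀ good , covered notHere)
  where
  covered : ¬ (here ∈dfv Q₀) → DfvCovered Same (renC (ren1 n) Q₀) (cutB 𝕞 (mvar n) Q₀)
  covered notHere x h with ∈dfv-renC⁻¹ (ren1 n) Q₀ x h
  ... | here    , d , _ = ⊥-elim (notHere d)
  ... | there z , d , e = z , sym e , d

explains-ax-e1 : ∀ {Γ Θ} (v : Val Γ) (C : Ctx T (𝕖 ∷ Γ) V Θ) →
                 ExplainsRoot v (plug C (evar (wkΘ Θ here)))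
                   (cut 𝕖 v (plug C (renV (λ x → wkΘ Θ (there x)) v))) C
explains-ax-e1 v C = explains-root-exp v C (explains-small (renV _ v) (≤-reflexive (sizeV-renV _ v)))

explains-ax-e2 : ∀ {Γ Θ} (f : Γ ∋ 𝕖) (C : Ctx T (𝕖 ∷ Γ) T Θ) (kx : Kind)
                 (t : Tm (kx ∷ (Θ ⋈ (𝕖 ∷ Γ)))) →
                 ExplainsRoot (evar f) (plug C (der (wkΘ Θ here) kx t))
                   (cut 𝕖 (evar f) (plug C (der (wkΘ Θ (there f)) kx t))) C
explains-ax-e2 {Θ = Θ} f C kx t = explains-root-exp (evar f) C
  (explains-der-swap _ (holeRel-refl Same (λ _ → refl) (cutB 𝕖 (evar f) C)) _
     (wkΘ Θ here) (wkΘ Θ (there f))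
     (holePred-self-cut (evar f) C) kx t)

explains-tensor : ∀ {Γ Θ Φ Φ' k₁ k₂} (M : Ctx T Γ T Θ) (t : Tm (k₂ ∷ k₁ ∷ (Θ ⋈ Γ)))
  (L : Ctx T Γ T Φ) → IsL L → (v₁ : Val (Φ ⋈ Γ)) → (L' : Ctx T Γ T Φ') → IsL L' → (v₂ : Val (Φ' ⋈ Γ)) →
  ExplainsRoot (pair (plug L (val v₁)) (plug L' (val v₂)))
    (plug (renC there M) (par (wkΘ Θ here) k₁ k₂ (renT (ext (ext (liftΘ Θ there))) t)))
    (plug M
      (plug (renC (wkΘ Θ) L)
        (cut k₁ (renV (liftΘ Φ (wkΘ Θ)) v₁)
          (plug (renC (λ x → there (wkΘ Φ (wkΘ Θ x))) L')
            (cut k₂ (renV (liftΘ Φ' (λ x → there (wkΘ Φ (wkΘ Θ x)))) v₂)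
              (renT (ext (λ a → wkΘ Φ' (ext (wkΘ Φ) a))) t))))))
    (renC there M)
explains-tensor {Γ} {Θ} {Φ} {Φ'} M t L il v₁ L' il' v₂ =
  explains-root-mult M
    (explains-intro-Lcut L il v₁ (m+n≤o⇒m≤o _ (n≤1+n _)) (wkΘ Θ)
      (explains-intro-Lcut L' il' v₂ (m+n≤o⇒n≤o _ (n≤1+n _)) (λ x → there (wkΘ Φ (wkΘ Θ x)))
        (explains-par-body (liftΘ Θ there) (λ a → wkΘ Φ' (ext (wkΘ Φ) a)) _ related _ (wkΘ Θ here)
          (holePred-wk (correspond-shift M) (cutPred none) here tt) t)))
  where
  L₁ : Ctx T (Θ ⋈ Γ) T Φ
  L₁ = renC (wkΘ Θ) L
  L₂ : Ctx T (_ ∷ (Φ ⋈ (Θ ⋈ Γ))) T Φ'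
  L₂ = renC (λ x → there (wkΘ Φ (wkΘ Θ x))) L'
  related : ∀ {k} (x : (Θ ⋈ Γ) ∋ k) →
            leftRel L₂ (weakRelˡ (leftRel L₁ (holeRel (correspond-shift M))))
              (wkΘ Φ' (there (wkΘ Φ x))) (liftΘ Θ there x)
  related x = leftRel-wk (renC _ L') (IsL-renC _ L' il') (there (wkΘ Φ x)) _
                (leftRel-wk (renC (wkΘ Θ) L) (IsL-renC _ L il) x _ (holeRel-shift M x))

explains-lolli : ∀ {Γ Θ Φ} (ky kx : Kind) (M : Ctx T Γ T Θ) (w : Val (Θ ⋈ Γ)) (t : Tm (kx ∷ (Θ ⋈ Γ)))
  (L : Ctx T (ky ∷ Γ) T Φ) → IsL L → (v' : Val (Φ ⋈ (ky ∷ Γ))) →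
  ExplainsRoot (lam ky (plug L (val v')))
    (plug (renC there M) (sub (wkΘ Θ here) (renV (liftΘ Θ there) w) kx (renT (ext (liftΘ Θ there)) t)))
    (plug M
      (cut ky w
        (plug (renC (ext (wkΘ Θ)) L)
          (cut kx (renV (liftΘ Φ (ext (wkΘ Θ))) v')
            (renT (ext (λ a → wkΘ Φ (there a))) t)))))
    (renC there M)
explains-lolli {Γ} {Θ} {Φ} ky kx M w t L il v' =
  explains-root-mult M
    (explains-intro-cut argument
      (explains-intro-Lcut L il v' (n≤1+n _) (ext (wkΘ Θ))
        (explains-sub-body (liftΘ Θ there) (λ a → wkΘ Φ (there a)) _ related _ (wkΘ Θ here) consumed
          (renV (liftΘ Θ there) w) t)))
  where
  consumed : holePred (correspond-shift M) (cutPred none) (wkΘ Θ here)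
  consumed = holePred-wk (correspond-shift M) (cutPred none) here tt
  related : ∀ {k} (x : (Θ ⋈ Γ) ∋ k) →
            leftRel (renC (ext (wkΘ Θ)) L) (weakRelˡ (holeRel (correspond-shift M)))
              (wkΘ Φ (there x)) (liftΘ Θ there x)
  related x = leftRel-wk (renC _ L) (IsL-renC _ L il) (there x) _ (holeRel-shift M x)
  -- the argument w of the consumed sub(m, w, x.t) becomes the value of the new cut on y
  argument : ∀ {Θ'} (Q : Ctx V (Θ ⋈ Γ) V Θ') w₀ → Plugged Q w₀ w →
             Explained (holeRel (correspond-shift M)) (holePred (correspond-shift M) (cutPred none))
               (suc (sizeT (plug L (val v'))))
               (sub (wkΘ Θ here) (renV (liftΘ Θ there) w) kx (renT (ext (liftΘ Θ there)) t))
               ⊤ none (cutV ky Q _) w₀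
  argument {Θ'} Q w₀ p =
    traced (origin (subV (wkΘ Θ here) (renC (liftΘ Θ there) Q) kx (renT (ext (liftΘ Θ there)) t))
                   (renV (liftΘ Θ' (liftΘ Θ there)) w₀) (p-subV (plugged-ren (liftΘ Θ there) p))
                   (≤-reflexive (sym (sizeV-renV _ w₀)))
                   (λ _ np → ⊥-elim (np (wkΘ Θ here) consumed (inj₁ (SameVar-refl (wkΘ Θ here))))))

explains-bang-der : ∀ {Γ Θ Φ} (C : Ctx T (𝕖 ∷ Γ) T Θ) (kx : Kind) (t : Tm (kx ∷ (Θ ⋈ (𝕖 ∷ Γ))))
  (L : Ctx T Γ T Φ) → IsL L → (v : Val (Φ ⋈ Γ)) →
  ExplainsRoot (bang (plug L (val v))) (plug C (der (wkΘ Θ here) kx t))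
    (cut 𝕖 (bang (plug L (val v)))
      (plug C
        (plug (renC (λ x → wkΘ Θ (there x)) L)
          (cut kx (renV (liftΘ Φ (λ x → wkΘ Θ (there x))) v)
            (renT (ext (wkΘ Φ)) t)))))
    C
explains-bang-der {Γ} {Θ} {Φ} C kx t L il v =
  explains-root-exp (bang (plug L (val v))) C
    (explains-intro-Lcut L il v (n≤1+n _) (λ x → wkΘ Θ (there x))
      (explains-der-body (wkΘ Φ) _ related _ (wkΘ Θ here)
        (holePred-self-cut (bang (plug L (val v))) C) t))
  where
  related : ∀ {k} (x : (Θ ⋈ (𝕖 ∷ Γ)) ∋ k) →
            leftRel (renC (λ x → wkΘ Θ (there x)) L)
              (holeRel (correspond-self (cutB 𝕖 (bang (plug L (val v))) C))) (wkΘ Φ x) x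
  related x = leftRel-wk (renC _ L) (IsL-renC _ L il) x x
                (holeRel-refl Same (λ _ → refl) (cutB 𝕖 (bang (plug L (val v))) C) x)

explains-root : ∀ {Γ k} {v : Val Γ} {body r s Θ} {D : Ctx T (k ∷ Γ) s Θ} →
                RootStep k v body r D → ExplainsRoot v body r D
explains-root (ax-m1 v _ _ M _ _ refl refl)                           = explains-ax-m1 v M
explains-root (ax-m2 n body _ _ _ _ _ refl)                           = explains-ax-m2 n body
explains-root (tensor _ _ _ _ M _ t L il v₁ refl L' il' v₂ refl refl refl) =
  explains-tensor M t L il v₁ L' il' v₂
explains-root (lolli ky kx _ _ _ M _ w t L il v' refl refl refl)      = explains-lolli ky kx M w t L il v'
explains-root (ax-e1 v _ _ C _ refl refl)                             = explains-ax-e1 v C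
explains-root (ax-e2 f _ _ C kx t refl refl)                          = explains-ax-e2 f C kx t
explains-root (bang-der _ _ _ C kx t L il v refl refl refl)           = explains-bang-der C kx t L il v

explains-weak : ∀ {Δ} (v : Val Δ) (r : Tm Δ) →
                Explains T Same none (sizeV v) (cut 𝕖 v (renT there r)) r ⊤ none
explains-weak v r {Θ} Q w p =
  traced (origin (cutB 𝕖 v (renC there Q)) (renV (liftΘ Θ there) w) (p-cutB (plugged-ren there p))
                 (≤-reflexive (sym (sizeV-renV _ w)))
                 (λ (good , _) _ → Good-renC⁻¹ there Q good , λ x h → x , refl , ∈dfv-renC there Q x h))

record BadValue {s Γ} (t : El s Γ) (n : ℕ) : Set where
  constructor badValue
  field
    {Θ}     : List Kind
    ctx     : Ctx s Γ V Θ
    value   : Val (Θ ⋈ Γ)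
    plugged : Plugged ctx value t
    bad     : Bad ctx
    size≥   : n ≤ sizeV value

badValue-plug : ∀ {s Γ s' Θ} (E : Ctx s Γ s' Θ) {a : El s' (Θ ⋈ Γ)} {n} →
                BadValue a n → BadValue (plug E a) n
badValue-plug hole b = b
badValue-plug (pairL E t) b =
  let badValue Q w p bad n≤ = badValue-plug E b in badValue (pairL Q t) w (p-pairL p) bad n≤
badValue-plug (pairR t E) b =
  let badValue Q w p bad n≤ = badValue-plug E b in badValue (pairR t Q) w (p-pairR p) bad n≤
badValue-plug (lamC k E) b =
  let badValue Q w p bad n≤ = badValue-plug E b in badValue (lamC k Q) w (p-lamC p) bad n≤
badValue-plug (bangC E) b =
  let badValue Q w p bad n≤ = badValue-plug E b in badValue (bangC Q) w (p-bangC p) bad n≤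
badValue-plug (valC E) b =
  let badValue Q w p bad n≤ = badValue-plug E b in badValue (valC Q) w (p-valC p) bad n≤
badValue-plug (cutV k E t) b =
  let badValue Q w p bad n≤ = badValue-plug E b in badValue (cutV k Q t) w (p-cutV p) (λ ()) n≤
badValue-plug (cutB k v E) b =
  let badValue Q w p bad n≤ = badValue-plug E b in badValue (cutB k v Q) w (p-cutB p) (bad ∘ proj₁) n≤
badValue-plug (parB m k₁ k₂ E) b =
  let badValue Q w p bad n≤ = badValue-plug E b in badValue (parB m k₁ k₂ Q) w (p-parB p) bad n≤
badValue-plug (subV m E k t) b =
  let badValue Q w p bad n≤ = badValue-plug E b in badValue (subV m Q k t) w (p-subV p) bad n≤
badValue-plug (subB m v k E) b =
  let badValue Q w p bad n≤ = badValue-plug E b in badValue (subB m v k Q) w (p-subB p) bad n≤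
badValue-plug (derB e k E) b =
  let badValue Q w p bad n≤ = badValue-plug E b in badValue (derB e k Q) w (p-derB p) bad n≤

-- A small occurrence is bounded by the fired value v, which is bad in t: cut(⟨·⟩, x.body)
-- is a bad context.
badValue-redex⁻¹ : ∀ {Γ Θ k n} (C : Ctx T Γ T Θ) (v : Val (Θ ⋈ Γ)) (body : Tm (k ∷ (Θ ⋈ Γ)))
                 {b g} {d : VarPred (Θ ⋈ Γ)} →
                 Explains T Same none (sizeV v) (cut k v body) b g d → GoodPlug C g d →
                 BadValue (plug C b) n → BadValue (plug C (cut k v body)) n
badValue-redex⁻¹ C v body e good (badValue Q w p bad n≤)
  with frame (correspond-self C) {P = none}
              (explains-mono (holeRel-self C) (λ _ ()) ≤-refl id (λ _ h → h) e) Q w p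
... | traced (origin Q' w' p' w≤ reflect) =
        badValue Q' w' p' (λ good' → bad (proj₁ (reflect good' (λ _ ())))) (≤-trans n≤ w≤)
... | created c = ⊥-elim (bad (proj₁ (c good)))
... | small w≤  =
        badValue-plug C (badValue (cutV _ hole body) v (p-cutV p-hole) (λ ()) (≤-trans n≤ w≤))

badValue-step⁻¹ : ∀ {Γ} {t s : Tm Γ} → t →G s → ∀ {n} → BadValue s n → BadValue t n
badValue-step⁻¹ (_ , root-step {k = k} C v body r D rs refl refl refl , good) =
  badValue-redex⁻¹ C v body (explains-root rs) (GoodPlug-compose C (cutB k v D) good)
badValue-step⁻¹ (_ , w-step C _ _ (weak v _ r _ refl) refl refl refl , good) =
  badValue-redex⁻¹ C v (renT there r) (explains-weak v r) (GoodPlug-none C good)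

badValue-steps⁻¹ : ∀ {Γ} {t s : Tm Γ} → t →G* s → ∀ {n} → BadValue s n → BadValue t n
badValue-steps⁻¹ ε           b = b
badValue-steps⁻¹ (st ◅ sts) b = badValue-step⁻¹ st (badValue-steps⁻¹ sts b)

theorem11p9 : ∀ {Γ : Scope} (t s : Tm Γ) → t →G* s →
              ∀ {Θ : List Kind} (C : Ctx T Γ V Θ) (v : Val (Θ ⋈ Γ)) →
              plug C v ≡ s → Bad C → sizeV v ≤ sizeT t
theorem11p9 t s steps C v refl bad =
  let badValue _ w p _ v≤w = badValue-steps⁻¹ steps (badValue C v (plugged-plug C v) bad ≤-refl)
  in ≤-trans v≤w (plugged-size≤ p)
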